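{- Let $q>2$ be a prime power, $s\geq 3$ an integer, and let $\Omega$ be a non-empty family of hyperplanes of $\mathrm{PG}(s,q^2)$ such that every point lies in exactly $\frac{q^s(q^{s-1}-(-1)^{s-1})}{q+1}$ or exactly $\frac{q^{s-1}(q^s-(-1)^s)}{q+1}$ hyperplanes of $\Omega$. Call a point black if it lies in exactly $\frac{q^s(q^{s-1}-(-1)^{s-1})}{q+1}$ hyperplanes of $\Omega$. Then every hyperplane of $\mathrm{PG}(s,q^2)$ not in $\Omega$ contains exactly $1+q^2N_{s-2}$ black points.
   Context: For $n\geq -1$, $N_n=\frac{(q^{n+1}+(-1)^n)(q^n-(-1)^n)}{q^2-1}$ is the number of points of a non-singular hermitian variety $\mathcal H(n,q^2)$; $1+q^2N_{s-2}$ is the number of points of a cone $p\mathcal H(s-2,q^2)$ with a point vertex. -}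

module Defs where

open import Level using (0ℓ)
open import Data.Bool using (Bool; true; false; _∧_)
open import Data.Nat as ℕ using (ℕ; zero; suc)
open import Data.Nat.Primality using (Prime)
open import Data.Integer as ℤ using (ℤ; +_)
open import Data.Integer.DivMod using (_/ℕ_)
open import Data.List using (List; []; _∷_; length; filterᵇ; cartesianProductWith; concatMap; map)
open import Data.List.Membership.Propositional using (_∈_)
open import Data.List.Relation.Unary.Unique.Propositional using (Unique)
open import Data.Vec using (Vec; []; _∷_)
open import Data.Product using (∃; ∃-syntax; _×_)
open import Data.Sum using (_⊎_)
open import Data.Empty using (⊥)
open import Algebra.Structures using (IsCommutativeRing)
open import Relation.Binary.PropositionalEquality using (_≡_; _≢_)
open import Relation.Binary.Definitions using (DecidableEquality)
open import Relation.Nullary using (⌊_⌋)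

IsPrimePower : ℕ → Set
IsPrimePower q = ∃[ p ] ∃[ k ] (Prime p × q ≡ p ℕ.^ suc k)

record FiniteField (order : ℕ) : Set₁ where
  field
    Carrier : Set
    _+_ _*_ : Carrier → Carrier → Carrier
    -_      : Carrier → Carrier
    0# 1#   : Carrier
    isCommutativeRing : IsCommutativeRing _≡_ _+_ _*_ -_ 0# 1#
    0≢1     : 0# ≢ 1#
    inverse : ∀ x → x ≢ 0# → ∃[ y ] (x * y ≡ 1#)
    _≟_     : DecidableEquality Carrier
    elements : List Carrier
    complete : ∀ x → x ∈ elements
    unique   : Unique elements
    size     : length elements ≡ order

-- A point (and, dually, a hyperplane)
-- is represented by its unique normalised homogeneous coordinate vector
-- in F^(s+1): the first non-zero coordinate equals 1.  A point x lies
-- on the hyperplane with coordinates h iff  Σ x_i h_i = 0.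

module PG {order : ℕ} (F : FiniteField order) where
  open FiniteField F

  Normalised : ∀ {n} → Vec Carrier n → Set
  Normalised []       = ⊥
  Normalised (x ∷ xs) = (x ≡ 1#) ⊎ ((x ≡ 0#) × Normalised xs)

  normalised? : ∀ {n} → Vec Carrier n → Bool
  normalised? []       = false
  normalised? (x ∷ xs) with ⌊ x ≟ 1# ⌋ | ⌊ x ≟ 0# ⌋
  ... | true  | _     = true
  ... | false | true  = normalised? xs
  ... | false | false = false

  allVecs : ∀ n → List (Vec Carrier n)
  allVecs zero    = [] ∷ []
  allVecs (suc n) = cartesianProductWith _∷_ elements (allVecs n)

  points : ∀ s → List (Vec Carrier (suc s))
  points s = filterᵇ normalised? (allVecs (suc s))

  hyperplanes : ∀ s → List (Vec Carrier (suc s))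
  hyperplanes = points

  dot : ∀ {n} → Vec Carrier n → Vec Carrier n → Carrier
  dot []       []       = 0#
  dot (x ∷ xs) (y ∷ ys) = (x * y) + dot xs ys

  incident : ∀ {n} → Vec Carrier n → Vec Carrier n → Bool
  incident x h = ⌊ dot x h ≟ 0# ⌋

  degree : ∀ s → (Vec Carrier (suc s) → Bool) → Vec Carrier (suc s) → ℕ
  degree s Ω x = length (filterᵇ (λ h → Ω h ∧ incident x h) (hyperplanes s))

-- exact division helper (d ≠ 0 in all uses; returns 0 for d = 0)
divZ : ℤ → ℕ → ℤ
divZ a zero    = + 0
divZ a (suc d) = a /ℕ suc d

sgn : ℕ → ℤ
sgn n = (ℤ.- (+ 1)) ℤ.^ n

N : ℕ → ℕ → ℤ
N q n = divZ (((+ q) ℤ.^ suc n ℤ.+ sgn n) ℤ.* ((+ q) ℤ.^ n ℤ.- sgn n))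
             (q ℕ.* q ℕ.∸ 1)

-- q^s (q^{s-1} - (-1)^{s-1}) / (q+1), for s ≥ 1 (s = suc t)
blackDeg : ℕ → ℕ → ℤ
blackDeg q t = divZ ((+ q) ℤ.^ suc t ℤ.* ((+ q) ℤ.^ t ℤ.- sgn t)) (suc q)

-- q^{s-1} (q^s - (-1)^s) / (q+1), for s ≥ 1 (s = suc t)
otherDeg : ℕ → ℕ → ℤ
otherDeg q t = divZ ((+ q) ℤ.^ t ℤ.* ((+ q) ℤ.^ suc t ℤ.- sgn (suc t))) (suc q)

{-# OPTIONS --safe #-}
module Submission where

-- Write Q = q², s = t + 1 and [n] = 1 + Q + ⋯ + Q^(n-1), so that PG(s, Q) has [s + 1] points, a
-- hyperplane has [s] points and two distinct hyperplanes meet in [s - 1] points.  Let d(x) be the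
-- number of hyperplanes of Ω through x and ω = |Ω|.  Double counting gives Σ d = ω [s] and
-- Σ d² = ω [s] + ω (ω - 1) [s - 1].  As every d(x) is one of the two admitted values d_B, d_O, the sum
-- Σ (d - d_B)(d - d_O) vanishes, which is a quadratic equation for ω.  One of its roots is an explicit
-- integer ω₀, and [s - 1] does not divide the linear coefficient, so the other root is not an integer
-- and ω = ω₀.  For a hyperplane h ∉ Ω, counting the incidences of its points with Ω gives
-- (d_B - d_O) β + d_O [s] = ω [s - 1] for the number β of black points of h, which determines β.
--
-- The point counts come from classifying a pair of linear forms by rank.  For t = 2m + 2 and
-- t = 2m + 3 all quantities are polynomials in q and H = [m], since Q^m = 1 + (Q - 1) H, so the
-- identities between them are checked by the ring solver.

open import Function using (_∘_; _⇔_; mk⇔; Equivalence; case_of_)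
open import Data.Bool using (Bool; true; false; _∧_)
open import Data.Bool.Properties using (∧-comm; ∧-idem; ∧-identityʳ; ∧-zeroʳ; T?; T-≡)
open import Data.Nat using (ℕ; zero; suc; _∸_; s≤s)
import Data.Nat as ℕ
import Data.Nat.Properties as ℕ
open import Data.Nat.Divisibility using (>⇒∤)
import Data.Nat.Tactic.RingSolver as ℕ-Solver
open import Algebra.Properties.CommutativeSemigroup ℕ.+-commutativeSemigroup
  using () renaming (interchange to +-interchange)
open import Data.Integer using (ℤ)
import Data.Integer as ℤ
import Data.Integer.Properties as ℤ
open import Data.Integer.Divisibility.Signed using (_∣_; divides; ∣-refl; ∣m⇒∣m*n; ∣m+n∣m⇒∣n; ∣⇒∣ᵤ)
open import Data.Integer.DivMod using (_/ℕ_; _%ℕ_; a≡a%ℕn+[a/ℕn]*n; n%ℕd<d)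
import Data.Integer.Tactic.RingSolver as ℤ-Solver
open import Data.Product using (∃-syntax; _×_; _,_; proj₁; proj₂)
open import Data.Sum using (_⊎_; inj₁; inj₂)
open import Data.Empty using (⊥-elim)
open import Data.List using (List; []; _∷_; _++_; map; length; filterᵇ; cartesianProductWith)
open import Data.List.Membership.Propositional using (_∈_)
open import Data.List.Membership.Propositional.Properties using (∈-filter⁻)
open import Data.List.Relation.Unary.Any using (here; there)
import Data.List.Relation.Unary.All as All
import Data.List.Relation.Unary.AllPairs as AllPairs
open import Data.List.Relation.Unary.Unique.Propositional using (Unique)
import Data.List.Relation.Unary.Unique.Propositional.Properties as Unique
open import Data.Vec using (Vec)
open import Level using (0ℓ)
open import Algebra.Bundles using (CommutativeRing)
import Algebra.Properties.Group as GroupProperties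
open import Relation.Nullary using (¬_; yes; no; ⌊_⌋; contradiction)
open import Relation.Nullary.Decidable using (isYes≗does; dec-true; dec-false; does-⇔; _×-dec_)
open import Relation.Binary.PropositionalEquality
  using (_≡_; _≢_; refl; sym; trans; cong; cong₂; subst; module ≡-Reasoning)
open ≡-Reasoning
open import Defs

private variable
  X Y Z : Set

module _ where
  open import Data.Nat using (_+_; _*_)

  [_] : Bool → ℕ
  [ true ]  = 1
  [ false ] = 0

  [∧] : ∀ a b → [ a ∧ b ] ≡ [ a ] * [ b ]
  [∧] true  b = sym (ℕ.+-identityʳ [ b ])
  [∧] false b = refl

  ∑ : List X → (X → ℕ) → ℕ
  ∑ []       f = 0
  ∑ (x ∷ xs) f = f x + ∑ xs f

  syntax ∑ xs (λ x → e) = ∑[ x ∈ xs ] e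

  count : (X → Bool) → List X → ℕ
  count p xs = ∑[ x ∈ xs ] [ p x ]

  length-filterᵇ : ∀ p (xs : List X) → length (filterᵇ p xs) ≡ count p xs
  length-filterᵇ p []       = refl
  length-filterᵇ p (x ∷ xs) with p x
  ... | true  = cong suc (length-filterᵇ p xs)
  ... | false = length-filterᵇ p xs

  ∑-cong : ∀ (xs : List X) {f g} → (∀ {x} → x ∈ xs → f x ≡ g x) → ∑ xs f ≡ ∑ xs g
  ∑-cong []       f≡g = refl
  ∑-cong (x ∷ xs) f≡g = cong₂ _+_ (f≡g (here refl)) (∑-cong xs (f≡g ∘ there))

  ∑-+ : ∀ (xs : List X) f g → ∑[ x ∈ xs ] (f x + g x) ≡ ∑ xs f + ∑ xs g
  ∑-+ []       f g = refl
  ∑-+ (x ∷ xs) f g = trans (cong (λ s → f x + g x + s) (∑-+ xs f g)) (+-interchange (f x) (g x) _ _)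

  ∑-*ˡ : ∀ (xs : List X) c f → ∑[ x ∈ xs ] (c * f x) ≡ c * ∑ xs f
  ∑-*ˡ []       c f = sym (ℕ.*-zeroʳ c)
  ∑-*ˡ (x ∷ xs) c f = trans (cong (λ s → c * f x + s) (∑-*ˡ xs c f)) (sym (ℕ.*-distribˡ-+ c (f x) _))

  ∑-*ʳ : ∀ (xs : List X) c f → ∑[ x ∈ xs ] (f x * c) ≡ ∑ xs f * c
  ∑-*ʳ xs c f = trans (∑-cong xs λ {x} _ → ℕ.*-comm (f x) c) (trans (∑-*ˡ xs c f) (ℕ.*-comm c _))

  ∑-const : ∀ (xs : List X) c → ∑[ x ∈ xs ] c ≡ length xs * c
  ∑-const []       c = refl
  ∑-const (x ∷ xs) c = cong (λ s → c + s) (∑-const xs c)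

  ∑-zero : ∀ (xs : List X) → ∑[ x ∈ xs ] 0 ≡ 0
  ∑-zero xs = trans (∑-const xs 0) (ℕ.*-zeroʳ (length xs))

  ∑-comm : ∀ (xs : List X) (ys : List Y) (f : X → Y → ℕ) →
    ∑[ x ∈ xs ] ∑[ y ∈ ys ] f x y ≡ ∑[ y ∈ ys ] ∑[ x ∈ xs ] f x y
  ∑-comm []       ys f = sym (∑-zero ys)
  ∑-comm (x ∷ xs) ys f = trans (cong (λ s → ∑ ys (f x) + s) (∑-comm xs ys f)) (sym (∑-+ ys (f x) _))

  ∑-filterᵇ : ∀ p (xs : List X) f → ∑ (filterᵇ p xs) f ≡ ∑[ x ∈ xs ] ([ p x ] * f x)
  ∑-filterᵇ p []       f = refl
  ∑-filterᵇ p (x ∷ xs) f with p x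
  ... | true  = cong₂ _+_ (sym (ℕ.+-identityʳ (f x))) (∑-filterᵇ p xs f)
  ... | false = ∑-filterᵇ p xs f

  count-filterᵇ : ∀ p q (xs : List X) → count q (filterᵇ p xs) ≡ count (λ x → p x ∧ q x) xs
  count-filterᵇ p q xs = trans (∑-filterᵇ p xs _) (∑-cong xs λ {x} _ → sym ([∧] (p x) (q x)))

  ∑-++ : ∀ (xs ys : List X) f → ∑ (xs ++ ys) f ≡ ∑ xs f + ∑ ys f
  ∑-++ []       ys f = refl
  ∑-++ (x ∷ xs) ys f = trans (cong (λ s → f x + s) (∑-++ xs ys f)) (sym (ℕ.+-assoc (f x) _ _))

  ∑-map : ∀ (g : X → Y) xs f → ∑ (map g xs) f ≡ ∑[ x ∈ xs ] f (g x)
  ∑-map g []       f = refl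
  ∑-map g (x ∷ xs) f = cong (λ s → f (g x) + s) (∑-map g xs f)

  ∑-cartesianProductWith : ∀ (g : X → Y → Z) xs ys f →
    ∑ (cartesianProductWith g xs ys) f ≡ ∑[ x ∈ xs ] ∑[ y ∈ ys ] f (g x y)
  ∑-cartesianProductWith g []       ys f = refl
  ∑-cartesianProductWith g (x ∷ xs) ys f = trans (∑-++ (map (g x) ys) _ f)
    (cong₂ _+_ (∑-map (g x) ys f) (∑-cartesianProductWith g xs ys f))

  ∑-const-except : ∀ {xs : List X} {y f c} → Unique xs → y ∈ xs → (∀ {x} → x ∈ xs → x ≢ y → f x ≡ c) →
    ∑ xs f + c ≡ length xs * c + f y
  ∑-const-except {xs = x ∷ xs} {f = f} {c} (x∉xs AllPairs.∷ _) (here refl) f≡c = begin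
    f x + ∑ xs f + c         ≡⟨ cong (λ s → f x + s + c) (trans (∑-cong xs others) (∑-const xs c)) ⟩
    f x + length xs * c + c  ≡⟨ swap (f x) (length xs * c) c ⟩
    c + length xs * c + f x  ∎
    where
    others : ∀ {z} → z ∈ xs → f z ≡ c
    others z∈xs = f≡c (there z∈xs) λ z≡x → All.lookup x∉xs z∈xs (sym z≡x)
    swap : ∀ a b c → a + b + c ≡ c + b + a
    swap = ℕ-Solver.solve-∀
  ∑-const-except {xs = x ∷ xs} {y} {f} {c} (x∉xs AllPairs.∷ xs!) (there y∈xs) f≡c = begin
    f x + ∑ xs f + c          ≡⟨ ℕ.+-assoc (f x) _ c ⟩
    f x + (∑ xs f + c)        ≡⟨ cong₂ _+_ (f≡c (here refl) x≢y) (∑-const-except xs! y∈xs (f≡c ∘ there)) ⟩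
    c + (length xs * c + f y) ≡⟨ ℕ.+-assoc c _ (f y) ⟨
    c + length xs * c + f y   ∎
    where
    x≢y : x ≢ y
    x≢y refl = All.lookup x∉xs y∈xs refl

  ∑-single : ∀ {xs : List X} {y f} → Unique xs → y ∈ xs → (∀ {x} → x ∈ xs → x ≢ y → f x ≡ 0) →
    ∑ xs f ≡ f y
  ∑-single {xs = xs} {y} {f} xs! y∈xs f≡0 = begin
    ∑ xs f                ≡⟨ ℕ.+-identityʳ (∑ xs f) ⟨
    ∑ xs f + 0            ≡⟨ ∑-const-except xs! y∈xs f≡0 ⟩
    length xs * 0 + f y   ≡⟨ cong (λ s → s + f y) (ℕ.*-zeroʳ (length xs)) ⟩
    f y                   ∎

module _ where
  open import Data.Nat using (_+_; _*_; _^_)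

  geometricSum : ℕ → ℕ → ℕ
  geometricSum Q zero    = 0
  geometricSum Q (suc n) = 1 + Q * geometricSum Q n

  geometricSum-suc : ∀ Q n → Q ^ n + geometricSum Q n ≡ geometricSum Q (suc n)
  geometricSum-suc Q zero    = cong suc (sym (ℕ.*-zeroʳ Q))
  geometricSum-suc Q (suc n) = begin
    Q * Q ^ n + (1 + Q * geometricSum Q n)  ≡⟨ ℕ.+-suc _ _ ⟩
    1 + (Q * Q ^ n + Q * geometricSum Q n)  ≡⟨ cong suc (ℕ.*-distribˡ-+ Q _ _) ⟨
    1 + Q * (Q ^ n + geometricSum Q n)      ≡⟨ cong (λ s → 1 + Q * s) (geometricSum-suc Q n) ⟩
    1 + Q * geometricSum Q (suc n)          ∎

  geometricSum-+ : ∀ Q a b → geometricSum Q (a + b) ≡ geometricSum Q a + Q ^ a * geometricSum Q b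
  geometricSum-+ Q zero    b = sym (ℕ.+-identityʳ (geometricSum Q b))
  geometricSum-+ Q (suc a) b = begin
    1 + Q * geometricSum Q (a + b)                               ≡⟨ cong (λ s → 1 + Q * s) (geometricSum-+ Q a b) ⟩
    1 + Q * (geometricSum Q a + Q ^ a * geometricSum Q b)        ≡⟨ distribute Q (geometricSum Q a) (Q ^ a) (geometricSum Q b) ⟩
    1 + Q * geometricSum Q a + Q * Q ^ a * geometricSum Q b      ∎
    where
    distribute : ∀ Q g e h → 1 + Q * (g + e * h) ≡ 1 + Q * g + Q * e * h
    distribute = ℕ-Solver.solve-∀

-- Points of PG(n - 1, Q) on one or two hyperplanes

module PointCounts {Q : ℕ} (F : FiniteField Q) where
  open import Data.Vec using ([]; _∷_; replicate)
  open import Data.Vec.Properties using (∷-injective)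
  open import Data.Vec.Relation.Binary.Pointwise.Inductive using (Pointwise; []; _∷_; Pointwise-≡⇒≡)
  import Data.Vec.Relation.Binary.Pointwise.Inductive as Pointwise
  open FiniteField F renaming (_+_ to infixl 6 _+_; _*_ to infixl 7 _*_; -_ to infix 8 -_; _≟_ to infix 4 _≟_)

  commutativeRing : CommutativeRing 0ℓ 0ℓ
  commutativeRing = record { isCommutativeRing = isCommutativeRing }

  open CommutativeRing commutativeRing using
    (+-assoc; +-comm; *-assoc; *-comm; zeroˡ; zeroʳ; distribˡ; distribʳ; +-identityˡ; +-identityʳ; *-identityˡ; *-identityʳ)
  open GroupProperties (CommutativeRing.+-group commutativeRing)
    using () renaming (∙-cancelˡ to +-cancelˡ; ∙-cancelʳ to +-cancelʳ; //-rightDividesˡ to sub-add)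

  1≢0 : 1# ≢ 0#
  1≢0 = 0≢1 ∘ sym

  ⌊≟⌋-yes : ∀ {x y} → x ≡ y → ⌊ x ≟ y ⌋ ≡ true
  ⌊≟⌋-yes {x} {y} = trans (isYes≗does (x ≟ y)) ∘ dec-true (x ≟ y)

  ⌊≟⌋-no : ∀ {x y} → x ≢ y → ⌊ x ≟ y ⌋ ≡ false
  ⌊≟⌋-no {x} {y} = trans (isYes≗does (x ≟ y)) ∘ dec-false (x ≟ y)

  ⌊≟⌋-⇔ : ∀ {x y z w} → (x ≡ y ⇔ z ≡ w) → ⌊ x ≟ y ⌋ ≡ ⌊ z ≟ w ⌋
  ⌊≟⌋-⇔ {x} {y} {z} {w} iff =
    trans (isYes≗does (x ≟ y)) (trans (does-⇔ iff (x ≟ y) (z ≟ w)) (sym (isYes≗does (z ≟ w))))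

  *-cancelʳ : ∀ {x y z} → z ≢ 0# → x * z ≡ y * z → x ≡ y
  *-cancelʳ {x} {y} {z} z≢0 eq with inverse z z≢0
  ... | z⁻¹ , zz⁻¹≡1 = begin
    x                ≡⟨ cancel x ⟨
    x * z * z⁻¹      ≡⟨ cong (_* z⁻¹) eq ⟩
    y * z * z⁻¹      ≡⟨ cancel y ⟩
    y                ∎
    where
    cancel : ∀ u → u * z * z⁻¹ ≡ u
    cancel u = trans (*-assoc u z z⁻¹) (trans (cong (u *_) zz⁻¹≡1) (*-identityʳ u))

  zero-product : ∀ {x z} → z ≢ 0# → x * z ≡ 0# → x ≡ 0#
  zero-product z≢0 eq = *-cancelʳ z≢0 (trans eq (sym (zeroˡ _)))

  expand : ∀ e a h w → (e + a * h) * w ≡ e * w + a * (h * w)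
  expand e a h w = trans (distribʳ w e (a * h)) (cong (e * w +_) (*-assoc a h w))

  linear-root : ∀ X Y {d} → d ≢ 0# → ∃[ a₀ ] (∀ a → (X + a * d ≡ Y) ⇔ (a ≡ a₀))
  linear-root X Y {d} d≢0 with inverse d d≢0
  ... | d⁻¹ , dd⁻¹≡1 = a₀ , λ a → mk⇔
    (λ eq → *-cancelʳ d≢0 (+-cancelˡ X (a * d) (a₀ * d) (trans eq (sym a₀-root))))
    (λ { refl → a₀-root })
    where
    a₀ : Carrier
    a₀ = (Y + - X) * d⁻¹
    a₀-root : X + a₀ * d ≡ Y
    a₀-root = begin
      X + (Y + - X) * d⁻¹ * d   ≡⟨ cong (X +_) (*-assoc _ d⁻¹ d) ⟩
      X + (Y + - X) * (d⁻¹ * d) ≡⟨ cong (λ u → X + (Y + - X) * u) (trans (*-comm d⁻¹ d) dd⁻¹≡1) ⟩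
      X + (Y + - X) * 1#        ≡⟨ cong (X +_) (*-identityʳ _) ⟩
      X + (Y + - X)             ≡⟨ +-comm X _ ⟩
      Y + - X + X               ≡⟨ sub-add X Y ⟩
      Y                         ∎

  linear-root₂ : ∀ X Y {α β} → α ≢ β → ∃[ a₀ ] (∀ a → (X + a * α ≡ Y + a * β) ⇔ (a ≡ a₀))
  linear-root₂ X Y {α} {β} α≢β = a₀ , λ a → mk⇔ (to (root⇔ a) ∘ shift⇒ a) (shift⇐ a ∘ from (root⇔ a))
    where
    open Equivalence
    δ≢0 : α + - β ≢ 0#
    δ≢0 δ≡0 = α≢β (trans (sym (sub-add β α)) (trans (cong (_+ β) δ≡0) (+-identityˡ β)))
    a₀ : Carrier
    a₀ = proj₁ (linear-root X Y δ≢0)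
    root⇔ : ∀ a → (X + a * (α + - β) ≡ Y) ⇔ (a ≡ a₀)
    root⇔ = proj₂ (linear-root X Y δ≢0)
    regroup : ∀ a → X + a * (α + - β) + a * β ≡ X + a * α
    regroup a = trans (+-assoc X _ _) (cong (X +_) (trans (sym (distribˡ a _ β)) (cong (a *_) (sub-add β α))))
    shift⇒ : ∀ a → X + a * α ≡ Y + a * β → X + a * (α + - β) ≡ Y
    shift⇒ a eq = +-cancelʳ (a * β) _ Y (trans (regroup a) eq)
    shift⇐ : ∀ a → X + a * (α + - β) ≡ Y → X + a * α ≡ Y + a * β
    shift⇐ a eq = trans (sym (regroup a)) (cong (_+ a * β) eq)

  count-≟ : ∀ c → count (λ a → ⌊ a ≟ c ⌋) elements ≡ 1
  count-≟ c = trans (∑-single unique (complete c) (λ _ a≢c → cong [_] (⌊≟⌋-no a≢c))) (cong [_] (⌊≟⌋-yes refl))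

  count-unique : ∀ (p : Carrier → Bool) a₀ → (∀ a → p a ≡ ⌊ a ≟ a₀ ⌋) → count p elements ≡ 1
  count-unique p a₀ p≡ = trans (∑-cong elements (λ {a} _ → cong [_] (p≡ a))) (count-≟ a₀)

  open PG F

  zeros : ∀ n → Vec Carrier n
  zeros n = replicate n 0#

  dot-zeros : ∀ {n} (v : Vec Carrier n) → dot v (zeros n) ≡ 0#
  dot-zeros []      = refl
  dot-zeros (x ∷ v) = trans (cong₂ _+_ (zeroʳ x) (dot-zeros v)) (+-identityʳ 0#)

  incident-zeros : ∀ {n} (x : Vec Carrier n) → incident x (zeros n) ≡ true
  incident-zeros x = ⌊≟⌋-yes (dot-zeros x)

  ∑-allVecs : ∀ n (f : Vec Carrier (suc n) → ℕ) →
    ∑ (allVecs (suc n)) f ≡ ∑[ a ∈ elements ] ∑[ v ∈ allVecs n ] f (a ∷ v)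
  ∑-allVecs n = ∑-cartesianProductWith _∷_ elements (allVecs n)

  length-allVecs : ∀ n → length (allVecs n) ≡ Q ℕ.^ n
  length-allVecs zero    = refl
  length-allVecs (suc n) = begin
    length (allVecs (suc n))                 ≡⟨ length≡∑1 (allVecs (suc n)) ⟩
    ∑[ x ∈ allVecs (suc n) ] 1               ≡⟨ ∑-allVecs n (λ _ → 1) ⟩
    ∑[ a ∈ elements ] ∑[ v ∈ allVecs n ] 1   ≡⟨ ∑-cong elements (λ _ → sym (length≡∑1 (allVecs n))) ⟩
    ∑[ a ∈ elements ] length (allVecs n)     ≡⟨ ∑-const elements _ ⟩
    length elements ℕ.* length (allVecs n)   ≡⟨ cong₂ ℕ._*_ size (length-allVecs n) ⟩
    Q ℕ.* Q ℕ.^ n                            ∎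
    where
    length≡∑1 : ∀ {A : Set} (xs : List A) → length xs ≡ ∑[ x ∈ xs ] 1
    length≡∑1 xs = trans (sym (ℕ.*-identityʳ (length xs))) (sym (∑-const xs 1))

  count-const : ∀ n b → count {Vec Carrier n} (λ _ → b) (allVecs n) ≡ [ b ] ℕ.* Q ℕ.^ n
  count-const n b = trans (∑-const (allVecs n) [ b ]) (trans (cong (ℕ._* [ b ]) (length-allVecs n)) (ℕ.*-comm _ [ b ]))

  -- the normalised vectors of F^(n+1) are 1 ∷ v for any v, and 0 ∷ v for normalised v
  [normalised?-∷] : ∀ {n} a (v : Vec Carrier n) (P : Vec Carrier (suc n) → Bool) →
    [ normalised? (a ∷ v) ∧ P (a ∷ v) ] ≡
    [ ⌊ a ≟ 1# ⌋ ] ℕ.* [ P (1# ∷ v) ] ℕ.+ [ ⌊ a ≟ 0# ⌋ ] ℕ.* [ normalised? v ∧ P (0# ∷ v) ]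
  [normalised?-∷] a v P with a ≟ 1# | a ≟ 0#
  ... | yes refl | yes 1≡0 = contradiction 1≡0 1≢0
  ... | yes refl | no  _   = sym (trans (ℕ.+-identityʳ _) (ℕ.*-identityˡ _))
  ... | no  _    | yes refl = sym (ℕ.*-identityˡ _)
  ... | no  _    | no  _    = refl

  count-normalised-∷ : ∀ n (P : Vec Carrier (suc n) → Bool) →
    count (λ x → normalised? x ∧ P x) (allVecs (suc n)) ≡
    count (λ v → P (1# ∷ v)) (allVecs n) ℕ.+ count (λ v → normalised? v ∧ P (0# ∷ v)) (allVecs n)
  count-normalised-∷ n P = begin
    count (λ x → normalised? x ∧ P x) (allVecs (suc n))
      ≡⟨ ∑-allVecs n _ ⟩
    ∑[ a ∈ elements ] ∑[ v ∈ vs ] [ normalised? (a ∷ v) ∧ P (a ∷ v) ]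
      ≡⟨ ∑-cong elements (λ {a} _ → trans (∑-cong vs (λ {v} _ → [normalised?-∷] a v P)) (split a)) ⟩
    ∑[ a ∈ elements ] ([ ⌊ a ≟ 1# ⌋ ] ℕ.* count₁ ℕ.+ [ ⌊ a ≟ 0# ⌋ ] ℕ.* count₀)
      ≡⟨ ∑-+ elements _ _ ⟩
    ∑[ a ∈ elements ] ([ ⌊ a ≟ 1# ⌋ ] ℕ.* count₁) ℕ.+ ∑[ a ∈ elements ] ([ ⌊ a ≟ 0# ⌋ ] ℕ.* count₀)
      ≡⟨ cong₂ ℕ._+_ (trans (∑-*ʳ elements count₁ _) (cong (ℕ._* count₁) (count-≟ 1#)))
                     (trans (∑-*ʳ elements count₀ _) (cong (ℕ._* count₀) (count-≟ 0#))) ⟩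
    1 ℕ.* count₁ ℕ.+ 1 ℕ.* count₀
      ≡⟨ cong₂ ℕ._+_ (ℕ.*-identityˡ count₁) (ℕ.*-identityˡ count₀) ⟩
    count₁ ℕ.+ count₀ ∎
    where
    vs : List (Vec Carrier n)
    vs = allVecs n
    count₁ count₀ : ℕ
    count₁ = count (λ v → P (1# ∷ v)) vs
    count₀ = count (λ v → normalised? v ∧ P (0# ∷ v)) vs
    split : ∀ a →
      ∑[ v ∈ vs ] ([ ⌊ a ≟ 1# ⌋ ] ℕ.* [ P (1# ∷ v) ] ℕ.+ [ ⌊ a ≟ 0# ⌋ ] ℕ.* [ normalised? v ∧ P (0# ∷ v) ]) ≡
      [ ⌊ a ≟ 1# ⌋ ] ℕ.* count₁ ℕ.+ [ ⌊ a ≟ 0# ⌋ ] ℕ.* count₀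
    split a = trans (∑-+ vs _ _) (cong₂ ℕ._+_ (∑-*ˡ vs [ ⌊ a ≟ 1# ⌋ ] (λ v → [ P (1# ∷ v) ]))
                                              (∑-*ˡ vs [ ⌊ a ≟ 0# ⌋ ] (λ v → [ normalised? v ∧ P (0# ∷ v) ])))

  affineSolutions : ∀ n → Vec Carrier n → Vec Carrier n → Carrier → Carrier → ℕ
  affineSolutions n h k e f = count (λ v → ⌊ e + dot v h ≟ 0# ⌋ ∧ ⌊ f + dot v k ≟ 0# ⌋) (allVecs n)

  pointsOn : ∀ n → Vec Carrier n → Vec Carrier n → ℕ
  pointsOn n h k = count (λ x → normalised? x ∧ (incident x h ∧ incident x k)) (allVecs n)

  affineSolutions-∷ : ∀ n h₀ h k₀ k e f →
    affineSolutions (suc n) (h₀ ∷ h) (k₀ ∷ k) e f ≡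
    ∑[ a ∈ elements ] affineSolutions n h k (e + a * h₀) (f + a * k₀)
  affineSolutions-∷ n h₀ h k₀ k e f = trans (∑-allVecs n _) (∑-cong elements λ {a} _ → ∑-cong (allVecs n) λ {v} _ →
    cong₂ (λ x y → [ ⌊ x ≟ 0# ⌋ ∧ ⌊ y ≟ 0# ⌋ ])
          (sym (+-assoc e (a * h₀) (dot v h))) (sym (+-assoc f (a * k₀) (dot v k))))

  affineSolutions-zeros : ∀ n e f →
    affineSolutions n (zeros n) (zeros n) e f ≡ [ ⌊ e ≟ 0# ⌋ ∧ ⌊ f ≟ 0# ⌋ ] ℕ.* Q ℕ.^ n
  affineSolutions-zeros n e f = trans (∑-cong (allVecs n) λ {v} _ →
    cong₂ (λ x y → [ ⌊ x ≟ 0# ⌋ ∧ ⌊ y ≟ 0# ⌋ ]) (+-zeros e v) (+-zeros f v)) (count-const n _)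
    where
    +-zeros : ∀ c v → c + dot v (zeros n) ≡ c
    +-zeros c v = trans (cong (c +_) (dot-zeros v)) (+-identityʳ c)

  pointsOn-∷ : ∀ n h₀ h k₀ k →
    pointsOn (suc n) (h₀ ∷ h) (k₀ ∷ k) ≡ affineSolutions n h k (1# * h₀) (1# * k₀) ℕ.+ pointsOn n h k
  pointsOn-∷ n h₀ h k₀ k = trans (count-normalised-∷ n _) (cong (affineSolutions n h k (1# * h₀) (1# * k₀) ℕ.+_)
    (∑-cong (allVecs n) λ {v} _ → cong (λ b → [ normalised? v ∧ b ])
      (cong₂ (λ x y → ⌊ x ≟ 0# ⌋ ∧ ⌊ y ≟ 0# ⌋) (0*-+ h₀ (dot v h)) (0*-+ k₀ (dot v k)))))
    where
    0*-+ : ∀ c x → 0# * c + x ≡ x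
    0*-+ c x = trans (cong (_+ x) (zeroˡ c)) (+-identityˡ x)

  pointsOn-zeros : ∀ n → pointsOn n (zeros n) (zeros n) ≡ geometricSum Q n
  pointsOn-zeros zero    = refl
  pointsOn-zeros (suc n) = begin
    pointsOn (suc n) (zeros (suc n)) (zeros (suc n))                   ≡⟨ pointsOn-∷ n 0# (zeros n) 0# (zeros n) ⟩
    affineSolutions n (zeros n) (zeros n) (1# * 0#) (1# * 0#) ℕ.+ pointsOn n (zeros n) (zeros n)
      ≡⟨ cong₂ ℕ._+_ (trans (affineSolutions-zeros n _ _) (cong (λ b → [ b ∧ b ] ℕ.* Q ℕ.^ n) (⌊≟⌋-yes (zeroʳ 1#))))
                     (pointsOn-zeros n) ⟩
    1 ℕ.* Q ℕ.^ n ℕ.+ geometricSum Q n                                  ≡⟨ cong (ℕ._+ geometricSum Q n) (ℕ.*-identityˡ _) ⟩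
    Q ℕ.^ n ℕ.+ geometricSum Q n                                        ≡⟨ geometricSum-suc Q n ⟩
    geometricSum Q (suc n)                                              ∎

  common-root : ∀ e f {h₀ k₀} → h₀ ≢ 0# →
    count (λ a → ⌊ e + a * h₀ ≟ 0# ⌋ ∧ ⌊ f + a * k₀ ≟ 0# ⌋) elements ≡ [ ⌊ e * k₀ ≟ f * h₀ ⌋ ]
  common-root e f {h₀} {k₀} h₀≢0 = trans (∑-single unique (complete a₀) off) (cong [_] on)
    where
    open Equivalence
    a₀ : Carrier
    a₀ = proj₁ (linear-root e 0# h₀≢0)
    root⇔ : ∀ a → (e + a * h₀ ≡ 0#) ⇔ (a ≡ a₀)
    root⇔ = proj₂ (linear-root e 0# h₀≢0)
    off : ∀ {a} → a ∈ elements → a ≢ a₀ → [ ⌊ e + a * h₀ ≟ 0# ⌋ ∧ ⌊ f + a * k₀ ≟ 0# ⌋ ] ≡ 0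
    off {a} _ a≢a₀ = cong (λ b → [ b ∧ ⌊ f + a * k₀ ≟ 0# ⌋ ]) (⌊≟⌋-no (a≢a₀ ∘ to (root⇔ a)))
    Z₀ : Carrier
    Z₀ = a₀ * h₀ * k₀
    ek₀+Z₀ : e * k₀ + Z₀ ≡ 0#
    ek₀+Z₀ = trans (sym (distribʳ k₀ e (a₀ * h₀))) (trans (cong (_* k₀) (from (root⇔ a₀) refl)) (zeroˡ k₀))
    fh₀+Z₀ : (f + a₀ * k₀) * h₀ ≡ f * h₀ + Z₀
    fh₀+Z₀ = trans (expand f a₀ k₀ h₀)
                   (cong (λ x → f * h₀ + x) (trans (cong (a₀ *_) (*-comm k₀ h₀)) (sym (*-assoc a₀ h₀ k₀))))
    on : ⌊ e + a₀ * h₀ ≟ 0# ⌋ ∧ ⌊ f + a₀ * k₀ ≟ 0# ⌋ ≡ ⌊ e * k₀ ≟ f * h₀ ⌋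
    on = trans (cong (_∧ ⌊ f + a₀ * k₀ ≟ 0# ⌋) (⌊≟⌋-yes (from (root⇔ a₀) refl))) (⌊≟⌋-⇔ (mk⇔
      (λ f+a₀k₀≡0 → +-cancelʳ Z₀ _ _
         (trans ek₀+Z₀ (sym (trans (sym fh₀+Z₀) (trans (cong (_* h₀) f+a₀k₀≡0) (zeroˡ h₀))))))
      (λ ek₀≡fh₀ → zero-product h₀≢0 (trans fh₀+Z₀ (trans (cong (_+ Z₀) (sym ek₀≡fh₀)) ek₀+Z₀)))))

  Proportional : ∀ {n} → Carrier → Carrier → Vec Carrier n → Vec Carrier n → Set
  Proportional u w = Pointwise (λ a b → a * w ≡ b * u)

  -- the rank of the matrix with rows h and k, together with the counts it determines
  data Rank : ∀ n → Vec Carrier n → Vec Carrier n → Set where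
    rank₀ : ∀ {n} → Rank n (zeros n) (zeros n)
    rank₁ : ∀ {m h k} u w → ¬ (u ≡ 0# × w ≡ 0#) → Proportional u w h k →
            (∀ e f → affineSolutions (suc m) h k e f ≡ [ ⌊ e * w ≟ f * u ⌋ ] ℕ.* Q ℕ.^ m) →
            pointsOn (suc m) h k ≡ geometricSum Q m → Rank (suc m) h k
    rank₂ : ∀ {m h k} →
            (∀ e f → affineSolutions (suc (suc m)) h k e f ≡ Q ℕ.^ m) →
            pointsOn (suc (suc m)) h k ≡ geometricSum Q m → Rank (suc (suc m)) h k

  Q*[b*Qᵐ] : ∀ b m → Q ℕ.* ([ b ] ℕ.* Q ℕ.^ m) ≡ [ b ] ℕ.* Q ℕ.^ suc m
  Q*[b*Qᵐ] b m = trans (sym (ℕ.*-assoc Q [ b ] _)) (trans (cong (ℕ._* Q ℕ.^ m) (ℕ.*-comm Q [ b ])) (ℕ.*-assoc [ b ] Q _))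

  ∑-elements-const : ∀ c → ∑[ a ∈ elements ] c ≡ Q ℕ.* c
  ∑-elements-const c = trans (∑-const elements c) (cong (ℕ._* c) size)

  rank-∷zeros : ∀ n h₀ k₀ → Rank (suc n) (h₀ ∷ zeros n) (k₀ ∷ zeros n)
  rank-∷zeros n h₀ k₀ with h₀ ≟ 0# ×-dec k₀ ≟ 0#
  ... | yes (refl , refl) = rank₀
  ... | no h₀k₀≢0 = rank₁ h₀ k₀ h₀k₀≢0 (*-comm h₀ k₀ ∷ zeros-proportional n) solutions onBoth
    where
    zeros-proportional : ∀ n → Proportional h₀ k₀ (zeros n) (zeros n)
    zeros-proportional zero    = []
    zeros-proportional (suc n) = trans (zeroˡ k₀) (sym (zeroˡ h₀)) ∷ zeros-proportional n
    common-root′ : ∀ e f →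
      count (λ a → ⌊ e + a * h₀ ≟ 0# ⌋ ∧ ⌊ f + a * k₀ ≟ 0# ⌋) elements ≡ [ ⌊ e * k₀ ≟ f * h₀ ⌋ ]
    common-root′ e f with h₀ ≟ 0#
    ... | no h₀≢0 = common-root e f h₀≢0
    ... | yes h₀≡0 = begin
      count (λ a → ⌊ e + a * h₀ ≟ 0# ⌋ ∧ ⌊ f + a * k₀ ≟ 0# ⌋) elements
        ≡⟨ ∑-cong elements (λ {a} _ → cong [_] (∧-comm ⌊ e + a * h₀ ≟ 0# ⌋ _)) ⟩
      count (λ a → ⌊ f + a * k₀ ≟ 0# ⌋ ∧ ⌊ e + a * h₀ ≟ 0# ⌋) elements
        ≡⟨ common-root f e (λ k₀≡0 → h₀k₀≢0 (h₀≡0 , k₀≡0)) ⟩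
      [ ⌊ f * h₀ ≟ e * k₀ ⌋ ]
        ≡⟨ cong [_] (⌊≟⌋-⇔ (mk⇔ sym sym)) ⟩
      [ ⌊ e * k₀ ≟ f * h₀ ⌋ ] ∎
    solutions : ∀ e f →
      affineSolutions (suc n) (h₀ ∷ zeros n) (k₀ ∷ zeros n) e f ≡ [ ⌊ e * k₀ ≟ f * h₀ ⌋ ] ℕ.* Q ℕ.^ n
    solutions e f = begin
      affineSolutions (suc n) (h₀ ∷ zeros n) (k₀ ∷ zeros n) e f
        ≡⟨ affineSolutions-∷ n h₀ (zeros n) k₀ (zeros n) e f ⟩
      ∑[ a ∈ elements ] affineSolutions n (zeros n) (zeros n) (e + a * h₀) (f + a * k₀)
        ≡⟨ ∑-cong elements (λ _ → affineSolutions-zeros n _ _) ⟩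
      ∑[ a ∈ elements ] ([ ⌊ e + a * h₀ ≟ 0# ⌋ ∧ ⌊ f + a * k₀ ≟ 0# ⌋ ] ℕ.* Q ℕ.^ n)
        ≡⟨ ∑-*ʳ elements _ _ ⟩
      count (λ a → ⌊ e + a * h₀ ≟ 0# ⌋ ∧ ⌊ f + a * k₀ ≟ 0# ⌋) elements ℕ.* Q ℕ.^ n
        ≡⟨ cong (ℕ._* Q ℕ.^ n) (common-root′ e f) ⟩
      [ ⌊ e * k₀ ≟ f * h₀ ⌋ ] ℕ.* Q ℕ.^ n ∎
    not-both-zero : ⌊ 1# * h₀ ≟ 0# ⌋ ∧ ⌊ 1# * k₀ ≟ 0# ⌋ ≡ false
    not-both-zero with 1# * h₀ ≟ 0# | 1# * k₀ ≟ 0#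
    ... | yes h₀≡0 | yes k₀≡0 =
      contradiction (trans (sym (*-identityˡ h₀)) h₀≡0 , trans (sym (*-identityˡ k₀)) k₀≡0) h₀k₀≢0
    ... | yes _    | no  _    = refl
    ... | no  _    | _        = refl
    onBoth : pointsOn (suc n) (h₀ ∷ zeros n) (k₀ ∷ zeros n) ≡ geometricSum Q n
    onBoth = trans (pointsOn-∷ n h₀ (zeros n) k₀ (zeros n))
      (cong₂ ℕ._+_ (trans (affineSolutions-zeros n _ _) (cong (λ b → [ b ] ℕ.* Q ℕ.^ n) not-both-zero))
                   (pointsOn-zeros n))

  rank-∷rank₁ : ∀ {m h k} h₀ k₀ u w → ¬ (u ≡ 0# × w ≡ 0#) → Proportional u w h k →
    (∀ e f → affineSolutions (suc m) h k e f ≡ [ ⌊ e * w ≟ f * u ⌋ ] ℕ.* Q ℕ.^ m) →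
    pointsOn (suc m) h k ≡ geometricSum Q m → Rank (suc (suc m)) (h₀ ∷ h) (k₀ ∷ k)
  rank-∷rank₁ {m} {h} {k} h₀ k₀ u w uw≢0 h∝k solutions onBoth with h₀ * w ≟ k₀ * u
  ... | yes h₀w≡k₀u = rank₁ u w uw≢0 (h₀w≡k₀u ∷ h∝k) solutions′ onBoth′
    where
    shifted : ∀ e f a → ⌊ (e + a * h₀) * w ≟ (f + a * k₀) * u ⌋ ≡ ⌊ e * w ≟ f * u ⌋
    shifted e f a = ⌊≟⌋-⇔ (mk⇔
      (λ eq → +-cancelʳ (a * (k₀ * u)) _ _ (trans (cong (λ x → e * w + a * x) (sym h₀w≡k₀u))
                                                  (trans (sym (expand e a h₀ w)) (trans eq (expand f a k₀ u)))))
      (λ eq → trans (expand e a h₀ w) (trans (cong₂ (λ x y → x + a * y) eq h₀w≡k₀u) (sym (expand f a k₀ u)))))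
    solutions′ : ∀ e f →
      affineSolutions (suc (suc m)) (h₀ ∷ h) (k₀ ∷ k) e f ≡ [ ⌊ e * w ≟ f * u ⌋ ] ℕ.* Q ℕ.^ suc m
    solutions′ e f = begin
      affineSolutions (suc (suc m)) (h₀ ∷ h) (k₀ ∷ k) e f       ≡⟨ affineSolutions-∷ (suc m) h₀ h k₀ k e f ⟩
      ∑[ a ∈ elements ] affineSolutions (suc m) h k (e + a * h₀) (f + a * k₀)
        ≡⟨ ∑-cong elements (λ {a} _ → trans (solutions _ _) (cong (λ b → [ b ] ℕ.* Q ℕ.^ m) (shifted e f a))) ⟩
      ∑[ a ∈ elements ] ([ ⌊ e * w ≟ f * u ⌋ ] ℕ.* Q ℕ.^ m)     ≡⟨ ∑-elements-const _ ⟩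
      Q ℕ.* ([ ⌊ e * w ≟ f * u ⌋ ] ℕ.* Q ℕ.^ m)                ≡⟨ Q*[b*Qᵐ] ⌊ e * w ≟ f * u ⌋ m ⟩
      [ ⌊ e * w ≟ f * u ⌋ ] ℕ.* Q ℕ.^ suc m                    ∎
    1h₀w≡1k₀u : 1# * h₀ * w ≡ 1# * k₀ * u
    1h₀w≡1k₀u = trans (cong (_* w) (*-identityˡ h₀)) (trans h₀w≡k₀u (cong (_* u) (sym (*-identityˡ k₀))))
    onBoth′ : pointsOn (suc (suc m)) (h₀ ∷ h) (k₀ ∷ k) ≡ geometricSum Q (suc m)
    onBoth′ = begin
      pointsOn (suc (suc m)) (h₀ ∷ h) (k₀ ∷ k)                                   ≡⟨ pointsOn-∷ (suc m) h₀ h k₀ k ⟩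
      affineSolutions (suc m) h k (1# * h₀) (1# * k₀) ℕ.+ pointsOn (suc m) h k  ≡⟨ cong₂ ℕ._+_ (solutions _ _) onBoth ⟩
      [ ⌊ 1# * h₀ * w ≟ 1# * k₀ * u ⌋ ] ℕ.* Q ℕ.^ m ℕ.+ geometricSum Q m
        ≡⟨ cong (λ b → [ b ] ℕ.* Q ℕ.^ m ℕ.+ geometricSum Q m) (⌊≟⌋-yes 1h₀w≡1k₀u) ⟩
      1 ℕ.* Q ℕ.^ m ℕ.+ geometricSum Q m                                         ≡⟨ cong (ℕ._+ geometricSum Q m) (ℕ.*-identityˡ _) ⟩
      Q ℕ.^ m ℕ.+ geometricSum Q m                                               ≡⟨ geometricSum-suc Q m ⟩
      geometricSum Q (suc m)                                                     ∎
  ... | no h₀w≢k₀u = rank₂ solutions′ onBoth′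
    where
    open Equivalence
    solutions′ : ∀ e f → affineSolutions (suc (suc m)) (h₀ ∷ h) (k₀ ∷ k) e f ≡ Q ℕ.^ m
    solutions′ e f = begin
      affineSolutions (suc (suc m)) (h₀ ∷ h) (k₀ ∷ k) e f       ≡⟨ affineSolutions-∷ (suc m) h₀ h k₀ k e f ⟩
      ∑[ a ∈ elements ] affineSolutions (suc m) h k (e + a * h₀) (f + a * k₀)
        ≡⟨ ∑-cong elements (λ _ → solutions _ _) ⟩
      ∑[ a ∈ elements ] ([ ⌊ (e + a * h₀) * w ≟ (f + a * k₀) * u ⌋ ] ℕ.* Q ℕ.^ m)
        ≡⟨ ∑-*ʳ elements _ _ ⟩
      count (λ a → ⌊ (e + a * h₀) * w ≟ (f + a * k₀) * u ⌋) elements ℕ.* Q ℕ.^ m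
        ≡⟨ cong (ℕ._* Q ℕ.^ m)
                (count-unique _ a₀ λ a → ⌊≟⌋-⇔ (mk⇔ (to (root⇔ a) ∘ expanded⇒ a) (expanded⇐ a ∘ from (root⇔ a)))) ⟩
      1 ℕ.* Q ℕ.^ m                                              ≡⟨ ℕ.*-identityˡ _ ⟩
      Q ℕ.^ m                                                    ∎
      where
      a₀ : Carrier
      a₀ = proj₁ (linear-root₂ (e * w) (f * u) h₀w≢k₀u)
      root⇔ : ∀ a → (e * w + a * (h₀ * w) ≡ f * u + a * (k₀ * u)) ⇔ (a ≡ a₀)
      root⇔ = proj₂ (linear-root₂ (e * w) (f * u) h₀w≢k₀u)
      expanded⇒ : ∀ a → (e + a * h₀) * w ≡ (f + a * k₀) * u → e * w + a * (h₀ * w) ≡ f * u + a * (k₀ * u)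
      expanded⇒ a eq = trans (sym (expand e a h₀ w)) (trans eq (expand f a k₀ u))
      expanded⇐ : ∀ a → e * w + a * (h₀ * w) ≡ f * u + a * (k₀ * u) → (e + a * h₀) * w ≡ (f + a * k₀) * u
      expanded⇐ a eq = trans (expand e a h₀ w) (trans eq (sym (expand f a k₀ u)))
    onBoth′ : pointsOn (suc (suc m)) (h₀ ∷ h) (k₀ ∷ k) ≡ geometricSum Q m
    onBoth′ = trans (pointsOn-∷ (suc m) h₀ h k₀ k)
      (cong₂ ℕ._+_ (trans (solutions _ _) (cong (λ b → [ b ] ℕ.* Q ℕ.^ m) (⌊≟⌋-no 1h₀w≢1k₀u))) onBoth)
      where
      1h₀w≢1k₀u : 1# * h₀ * w ≢ 1# * k₀ * u
      1h₀w≢1k₀u eq = h₀w≢k₀u (trans (cong (_* w) (sym (*-identityˡ h₀))) (trans eq (cong (_* u) (*-identityˡ k₀))))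

  rank-∷rank₂ : ∀ {m h k} h₀ k₀ → (∀ e f → affineSolutions (suc (suc m)) h k e f ≡ Q ℕ.^ m) →
    pointsOn (suc (suc m)) h k ≡ geometricSum Q m → Rank (suc (suc (suc m))) (h₀ ∷ h) (k₀ ∷ k)
  rank-∷rank₂ {m} {h} {k} h₀ k₀ solutions onBoth = rank₂
    (λ e f → trans (affineSolutions-∷ (suc (suc m)) h₀ h k₀ k e f)
               (trans (∑-cong elements (λ _ → solutions _ _)) (∑-elements-const (Q ℕ.^ m))))
    (trans (pointsOn-∷ (suc (suc m)) h₀ h k₀ k) (trans (cong₂ ℕ._+_ (solutions _ _) onBoth) (geometricSum-suc Q m)))

  rank : ∀ n h k → Rank n h k
  rank zero    []       []       = rank₀
  rank (suc n) (h₀ ∷ h) (k₀ ∷ k) with rank n h k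
  ... | rank₀                             = rank-∷zeros n h₀ k₀
  ... | rank₁ u w uw≢0 h∝k solutions onBoth = rank-∷rank₁ h₀ k₀ u w uw≢0 h∝k solutions onBoth
  ... | rank₂ solutions onBoth             = rank-∷rank₂ h₀ k₀ solutions onBoth

  normalised-sound : ∀ {n} (x : Vec Carrier n) → normalised? x ≡ true → Normalised x
  normalised-sound (a ∷ x) eq with a ≟ 1# | a ≟ 0#
  ... | yes a≡1 | _       = inj₁ a≡1
  ... | no  _   | yes a≡0 = inj₂ (a≡0 , normalised-sound x eq)

  zeros-not-normalised : ∀ n → ¬ Normalised (zeros n)
  zeros-not-normalised (suc n) (inj₁ 0≡1)      = 0≢1 0≡1
  zeros-not-normalised (suc n) (inj₂ (_ , nx)) = zeros-not-normalised n nx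

  proportional-to-zero : ∀ {n u} {h k : Vec Carrier n} → u ≢ 0# → Proportional u 0# h k → k ≡ zeros n
  proportional-to-zero u≢0 []          = refl
  proportional-to-zero u≢0 (c ∷ h∝k) =
    cong₂ _∷_ (zero-product u≢0 (trans (sym c) (zeroʳ _))) (proportional-to-zero u≢0 h∝k)

  leading-1-0 : ∀ {n u w} {h k : Vec Carrier n} → ¬ (u ≡ 0# × w ≡ 0#) → Proportional u w (1# ∷ h) (0# ∷ k) →
    ¬ Normalised k
  leading-1-0 {u = u} {w} uw≢0 (c ∷ h∝k) nk =
    zeros-not-normalised _ (subst Normalised (proportional-to-zero u≢0 (subst (λ v → Proportional u v _ _) w≡0 h∝k)) nk)
    where
    w≡0 : w ≡ 0#
    w≡0 = trans (sym (*-identityˡ w)) (trans c (zeroˡ u))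
    u≢0 : u ≢ 0#
    u≢0 u≡0 = uw≢0 (u≡0 , w≡0)

  proportional⇒≡ : ∀ {n u w} {h k : Vec Carrier n} → ¬ (u ≡ 0# × w ≡ 0#) → Proportional u w h k →
    Normalised h → Normalised k → h ≡ k
  proportional⇒≡ {u = u} {w} uw≢0 (c ∷ h∝k) (inj₁ refl) (inj₁ refl) =
    cong (1# ∷_) (Pointwise-≡⇒≡ (Pointwise.map (λ {a} {b} aw≡bu → *-cancelʳ w≢0 (trans aw≡bu (cong (b *_) (sym w≡u))))
                                               h∝k))
    where
    w≡u : w ≡ u
    w≡u = trans (sym (*-identityˡ w)) (trans c (*-identityˡ u))
    w≢0 : w ≢ 0#
    w≢0 w≡0 = uw≢0 (trans (sym w≡u) w≡0 , w≡0)
  proportional⇒≡ uw≢0 h∝k@(_ ∷ _) (inj₁ refl) (inj₂ (refl , nk)) = ⊥-elim (leading-1-0 uw≢0 h∝k nk)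
  proportional⇒≡ uw≢0 h∝k@(_ ∷ _) (inj₂ (refl , nh)) (inj₁ refl) =
    ⊥-elim (leading-1-0 (uw≢0 ∘ λ (w≡0 , u≡0) → u≡0 , w≡0) (Pointwise.sym sym h∝k) nh)
  proportional⇒≡ uw≢0 (c ∷ h∝k) (inj₂ (refl , nh)) (inj₂ (refl , nk)) =
    cong (0# ∷_) (proportional⇒≡ uw≢0 h∝k nh nk)

  Q≢0 : Q ≢ 0
  Q≢0 Q≡0 with elements | complete 0# | trans size Q≡0
  ... | _ ∷ _ | _ | ()

  Qᵐ≢0 : ∀ m → Q ℕ.^ m ≢ 0
  Qᵐ≢0 m = ℕ.≢-nonZero⁻¹ (Q ℕ.^ m) {{ℕ.m^n≢0 Q m {{ℕ.≢-nonZero Q≢0}}}}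

  no-solutions : ∀ n h e → affineSolutions n h (zeros n) e 1# ≡ 0
  no-solutions n h e = trans (∑-cong (allVecs n) λ {v} _ → cong (λ b → [ ⌊ e + dot v h ≟ 0# ⌋ ∧ b ]) (1+0≢0 v))
                             (trans (∑-cong (allVecs n) λ {v} _ → cong [_] (∧-zeroʳ _)) (∑-zero (allVecs n)))
    where
    1+0≢0 : ∀ v → ⌊ 1# + dot v (zeros n) ≟ 0# ⌋ ≡ false
    1+0≢0 v = ⌊≟⌋-no λ eq → 1≢0 (trans (sym (trans (cong (1# +_) (dot-zeros v)) (+-identityʳ 1#))) eq)

  allVecs-unique : ∀ n → Unique (allVecs n)
  allVecs-unique zero    = All.[] AllPairs.∷ AllPairs.[]
  allVecs-unique (suc n) = Unique.cartesianProductWith⁺ _∷_ ∷-injective unique (allVecs-unique n)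

  points-unique : ∀ s → Unique (points s)
  points-unique s = Unique.filter⁺ (T? ∘ normalised?) (allVecs-unique (suc s))

  ∈points⇒normalised : ∀ {s x} → x ∈ points s → normalised? x ≡ true
  ∈points⇒normalised {s} x∈ = Equivalence.to T-≡ (proj₂ (∈-filter⁻ (T? ∘ normalised?) {xs = allVecs (suc s)} x∈))

  count-points : ∀ s p → count p (points s) ≡ count (λ x → normalised? x ∧ p x) (allVecs (suc s))
  count-points s p = count-filterᵇ normalised? p (allVecs (suc s))

  length-points : ∀ s → length (points s) ≡ geometricSum Q (suc s)
  length-points s = begin
    length (points s)                                       ≡⟨ length-filterᵇ normalised? (allVecs (suc s)) ⟩
    count normalised? (allVecs (suc s))                     ≡⟨ ∑-cong (allVecs (suc s)) (λ {x} _ → cong [_] (on-zeros x)) ⟨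
    pointsOn (suc s) (zeros (suc s)) (zeros (suc s))        ≡⟨ pointsOn-zeros (suc s) ⟩
    geometricSum Q (suc s)                                  ∎
    where
    on-zeros : ∀ {n} (x : Vec Carrier n) → normalised? x ∧ (incident x (zeros n) ∧ incident x (zeros n)) ≡ normalised? x
    on-zeros x = trans (cong (λ b → normalised? x ∧ (b ∧ b)) (incident-zeros x)) (∧-identityʳ _)

  hyperplane-size : ∀ {s h} → h ∈ hyperplanes s → count (λ x → incident x h) (points s) ≡ geometricSum Q s
  hyperplane-size {s} {h} h∈ with rank (suc s) h (zeros (suc s)) | ∈points⇒normalised h∈
  ... | rank₀ | nh = contradiction (normalised-sound _ nh) (zeros-not-normalised _)
  ... | rank₁ _ _ _ _ _ onBoth | _ = trans (count-points s _) (trans (∑-cong (allVecs (suc s)) λ {x} _ →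
          cong (λ b → [ normalised? x ∧ b ]) (sym (trans (cong (incident x h ∧_) (incident-zeros x)) (∧-identityʳ _))))
        onBoth)
  ... | rank₂ {m} solutions _ | _ = contradiction (trans (sym (solutions 0# 1#)) (no-solutions _ h 0#)) (Qᵐ≢0 m)

  intersection-size : ∀ {t h k} → h ∈ hyperplanes (suc t) → k ∈ hyperplanes (suc t) → h ≢ k →
    count (λ x → incident x h ∧ incident x k) (points (suc t)) ≡ geometricSum Q t
  intersection-size {t} {h} {k} h∈ k∈ h≢k
    with rank (suc (suc t)) h k | ∈points⇒normalised h∈ | ∈points⇒normalised k∈
  ... | rank₀ | nh | _ = contradiction (normalised-sound _ nh) (zeros-not-normalised _)
  ... | rank₁ _ _ uw≢0 h∝k _ _ | nh | nk =
    contradiction (proportional⇒≡ uw≢0 h∝k (normalised-sound _ nh) (normalised-sound _ nk)) h≢k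
  ... | rank₂ _ onBoth | _ | _ = trans (count-points (suc t) _) onBoth

module _ where
  open import Data.Integer using (+_; -_; _+_; _-_; _*_; 0ℤ; 1ℤ; ∣_∣)
  open ℤ-Solver using (solve-∀)

  ∑-affine : ∀ (xs : List X) (f g : X → ℕ) (a c : ℤ) → (∀ {x} → x ∈ xs → + f x ≡ a * + g x + c) →
    + ∑ xs f ≡ a * + ∑ xs g + + length xs * c
  ∑-affine []       f g a c hyp = nil a c
    where
    nil : ∀ a c → 0ℤ ≡ a * 0ℤ + 0ℤ * c
    nil = solve-∀
  ∑-affine (x ∷ xs) f g a c hyp = begin
    + (f x ℕ.+ ∑ xs f)                                   ≡⟨ ℤ.pos-+ (f x) (∑ xs f) ⟩
    + f x + + ∑ xs f                                     ≡⟨ cong₂ _+_ (hyp (here refl)) (∑-affine xs f g a c (hyp ∘ there)) ⟩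
    a * + g x + c + (a * + ∑ xs g + + length xs * c)     ≡⟨ regroup a c (+ g x) (+ ∑ xs g) (+ length xs) ⟩
    a * (+ g x + + ∑ xs g) + (1ℤ + + length xs) * c      ≡⟨ cong (λ s → a * s + + suc (length xs) * c) (ℤ.pos-+ (g x) _) ⟨
    a * + (g x ℕ.+ ∑ xs g) + + suc (length xs) * c       ∎
    where
    regroup : ∀ a c u v n → a * u + c + (a * v + n * c) ≡ a * (u + v) + (1ℤ + n) * c
    regroup = solve-∀

  two-valued-square : ∀ {d a b : ℤ} → d ≡ a ⊎ d ≡ b → d * d ≡ (a + b) * d + - (a * b)
  two-valued-square {a = a} {b} (inj₁ refl) = at-a a b
    where
    at-a : ∀ a b → a * a ≡ (a + b) * a + - (a * b)
    at-a = solve-∀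
  two-valued-square {a = a} {b} (inj₂ refl) = at-b a b
    where
    at-b : ∀ a b → b * b ≡ (a + b) * b + - (a * b)
    at-b = solve-∀

  quadratic-from-moments : ∀ {A A₁ A₂ dB dO ω S₁ S₂ : ℤ} →
    S₂ + ω * A ≡ ω * (ω * A + A₁) → S₁ ≡ ω * A₁ → S₂ ≡ (dB + dO) * S₁ + A₂ * - (dB * dO) →
    A * ω * ω + (A₁ - A - (dB + dO) * A₁) * ω + dB * dO * A₂ ≡ 0ℤ
  quadratic-from-moments {A} {A₁} {A₂} {dB} {dO} {ω} second refl refl = begin
    A * ω * ω + (A₁ - A - (dB + dO) * A₁) * ω + dB * dO * A₂  ≡⟨ difference A A₁ A₂ dB dO ω ⟩
    ω * (ω * A + A₁) - (S₂ + ω * A)                          ≡⟨ cong (λ s → ω * (ω * A + A₁) - s) second ⟩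
    ω * (ω * A + A₁) - ω * (ω * A + A₁)                      ≡⟨ ℤ.+-inverseʳ (ω * (ω * A + A₁)) ⟩
    0ℤ                                                        ∎
    where
    S₂ : ℤ
    S₂ = (dB + dO) * (ω * A₁) + A₂ * - (dB * dO)
    difference : ∀ A A₁ A₂ dB dO ω → A * ω * ω + (A₁ - A - (dB + dO) * A₁) * ω + dB * dO * A₂ ≡
      ω * (ω * A + A₁) - ((dB + dO) * (ω * A₁) + A₂ * - (dB * dO) + ω * A)
    difference = solve-∀

  quadratic-root-unique : ∀ {a b c x y : ℤ} → a * x * x + b * x + c ≡ 0ℤ → a * y * y + b * y + c ≡ 0ℤ →
    ¬ (a ∣ b) → x ≡ y
  quadratic-root-unique {a} {b} {c} {x} {y} x-root y-root a∤b with ℤ.i*j≡0⇒i≡0∨j≡0 (x - y) factorised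
    where
    factorised : (x - y) * (a * (x + y) + b) ≡ 0ℤ
    factorised = begin
      (x - y) * (a * (x + y) + b)                         ≡⟨ difference a b c x y ⟩
      (a * x * x + b * x + c) - (a * y * y + b * y + c)  ≡⟨ cong₂ _-_ x-root y-root ⟩
      0ℤ                                                  ∎
      where
      difference : ∀ a b c x y → (x - y) * (a * (x + y) + b) ≡ (a * x * x + b * x + c) - (a * y * y + b * y + c)
      difference = solve-∀
  ... | inj₁ x-y≡0     = ℤ.i-j≡0⇒i≡j x y x-y≡0
  ... | inj₂ other≡0   = contradiction (divides (- (x + y)) b≡) a∤b
    where
    b≡ : b ≡ - (x + y) * a
    b≡ = begin
      b                                 ≡⟨ rearrange a b (x + y) ⟩
      (a * (x + y) + b) + - (x + y) * a ≡⟨ cong (λ s → s + - (x + y) * a) other≡0 ⟩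
      0ℤ + - (x + y) * a                ≡⟨ ℤ.+-identityˡ _ ⟩
      - (x + y) * a                     ∎
      where
      rearrange : ∀ a b s → b ≡ (a * s + b) + - s * a
      rearrange = solve-∀

  a∤a*k+r : ∀ {a r} k → r ≢ 0ℤ → ∣ r ∣ ℕ.< ∣ a ∣ → ¬ (a ∣ a * k + r)
  a∤a*k+r {a} {r} k r≢0 ∣r∣<∣a∣ a∣ak+r =
    >⇒∤ {{ℕ.≢-nonZero (r≢0 ∘ ℤ.∣i∣≡0⇒i≡0)}} ∣r∣<∣a∣ (∣⇒∣ᵤ (∣m+n∣m⇒∣n a∣ak+r (∣m⇒∣m*n k ∣-refl)))

  divZ-exact : ∀ {a x} d → a ≡ x * + suc d → divZ a (suc d) ≡ x
  divZ-exact {a} {x} d a≡xD = sym (ℤ.*-cancelʳ-≡ x y (+ D) (begin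
    x * + D        ≡⟨ a≡xD ⟨
    a              ≡⟨ a≡a%ℕn+[a/ℕn]*n a D ⟩
    + r + y * + D  ≡⟨ cong (λ r → + r + y * + D) r≡0 ⟩
    0ℤ + y * + D   ≡⟨ ℤ.+-identityˡ _ ⟩
    y * + D        ∎))
    where
    D r : ℕ
    D = suc d
    r = a %ℕ D
    y : ℤ
    y = a /ℕ D
    D∣r : + D ∣ + r
    D∣r = divides (x - y) (begin
      + r                      ≡⟨ add-sub (+ r) (y * + D) ⟩
      + r + y * + D - y * + D  ≡⟨ cong (λ s → s - y * + D) (trans (sym (a≡a%ℕn+[a/ℕn]*n a D)) a≡xD) ⟩
      x * + D - y * + D        ≡⟨ factor x y (+ D) ⟩
      (x - y) * + D            ∎)
      where
      add-sub : ∀ u v → u ≡ u + v - v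
      add-sub = solve-∀
      factor : ∀ x y d → x * d - y * d ≡ (x - y) * d
      factor = solve-∀
    r≡0 : r ≡ 0
    r≡0 with r | n%ℕd<d a D | D∣r
    ... | zero  | _   | _   = refl
    ... | suc _ | r<D | D∣r = contradiction (∣⇒∣ᵤ D∣r) (>⇒∤ r<D)

-- Double counting of incidences

module Incidence {Q : ℕ} (F : FiniteField Q) (t : ℕ) (Ω : Vec (FiniteField.Carrier F) (suc (suc t)) → Bool) where
  open import Data.Nat using (_+_; _*_)
  open FiniteField F using (Carrier)
  open PG F
  open PointCounts F using (hyperplane-size; intersection-size; points-unique)

  Point : Set
  Point = Vec Carrier (suc (suc t))

  pts Ωs : List Point
  pts = points (suc t)
  Ωs  = filterᵇ Ω pts

  ω : ℕ
  ω = length Ωs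

  deg : Point → ℕ
  deg = degree (suc t) Ω

  A A₁ : ℕ
  A  = geometricSum Q t
  A₁ = geometricSum Q (suc t)

  Ωs⊆pts : ∀ {K} → K ∈ Ωs → K ∈ pts
  Ωs⊆pts = proj₁ ∘ ∈-filter⁻ (T? ∘ Ω) {xs = pts}

  Ω-member : ∀ {K} → K ∈ Ωs → Ω K ≡ true
  Ω-member = Equivalence.to T-≡ ∘ proj₂ ∘ ∈-filter⁻ (T? ∘ Ω) {xs = pts}

  Ωs-unique : Unique Ωs
  Ωs-unique = Unique.filter⁺ (T? ∘ Ω) (points-unique (suc t))

  ∑-weighted-degree : ∀ (w : Point → ℕ) →
    ∑[ x ∈ pts ] (w x * deg x) ≡ ∑[ K ∈ Ωs ] ∑[ x ∈ pts ] (w x * [ incident x K ])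
  ∑-weighted-degree w = begin
    ∑[ x ∈ pts ] (w x * deg x)                          ≡⟨ ∑-cong pts (λ {x} _ → cong (w x *_) (deg≡ x)) ⟩
    ∑[ x ∈ pts ] (w x * count (incident x) Ωs)          ≡⟨ ∑-cong pts (λ {x} _ → sym (∑-*ˡ Ωs (w x) _)) ⟩
    ∑[ x ∈ pts ] ∑[ K ∈ Ωs ] (w x * [ incident x K ])   ≡⟨ ∑-comm pts Ωs _ ⟩
    ∑[ K ∈ Ωs ] ∑[ x ∈ pts ] (w x * [ incident x K ])   ∎
    where
    deg≡ : ∀ x → deg x ≡ count (incident x) Ωs
    deg≡ x = trans (length-filterᵇ _ pts) (sym (count-filterᵇ Ω (incident x) pts))

  ∑-incident² : ∀ K K′ →
    ∑[ x ∈ pts ] ([ incident x K ] * [ incident x K′ ]) ≡ count (λ x → incident x K ∧ incident x K′) pts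
  ∑-incident² K K′ = ∑-cong pts (λ {x} _ → sym ([∧] (incident x K) (incident x K′)))

  first-moment : ∑[ x ∈ pts ] deg x ≡ ω * A₁
  first-moment = begin
    ∑[ x ∈ pts ] deg x                                ≡⟨ ∑-cong pts (λ _ → sym (ℕ.*-identityˡ _)) ⟩
    ∑[ x ∈ pts ] (1 * deg x)                          ≡⟨ ∑-weighted-degree (λ _ → 1) ⟩
    ∑[ K ∈ Ωs ] ∑[ x ∈ pts ] (1 * [ incident x K ])   ≡⟨ ∑-cong Ωs (λ K∈ → trans (∑-cong pts (λ _ → ℕ.*-identityˡ _))
                                                                                (hyperplane-size (Ωs⊆pts K∈))) ⟩
    ∑[ K ∈ Ωs ] A₁                                    ≡⟨ ∑-const Ωs A₁ ⟩
    ω * A₁                                            ∎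

  meets-Ω : ∀ {K} → K ∈ Ωs →
    ∑[ K′ ∈ Ωs ] count (λ x → incident x K ∧ incident x K′) pts + A ≡ ω * A + A₁
  meets-Ω {K} K∈ = begin
    ∑[ K′ ∈ Ωs ] count (λ x → incident x K ∧ incident x K′) pts + A
      ≡⟨ ∑-const-except Ωs-unique K∈ (λ K′∈ K′≢K → intersection-size (Ωs⊆pts K∈) (Ωs⊆pts K′∈) (K′≢K ∘ sym)) ⟩
    ω * A + count (λ x → incident x K ∧ incident x K) pts
      ≡⟨ cong (ω * A +_) (∑-cong pts (λ {x} _ → cong [_] (∧-idem (incident x K)))) ⟩
    ω * A + count (λ x → incident x K) pts
      ≡⟨ cong (ω * A +_) (hyperplane-size (Ωs⊆pts K∈)) ⟩
    ω * A + A₁ ∎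

  second-moment : ∑[ x ∈ pts ] (deg x * deg x) + ω * A ≡ ω * (ω * A + A₁)
  second-moment = begin
    ∑[ x ∈ pts ] (deg x * deg x) + ω * A
      ≡⟨ cong₂ _+_ (∑-weighted-degree deg) (sym (∑-const Ωs A)) ⟩
    ∑[ K ∈ Ωs ] ∑[ x ∈ pts ] (deg x * [ incident x K ]) + ∑[ K ∈ Ωs ] A
      ≡⟨ cong (_+ ∑[ K ∈ Ωs ] A) (∑-cong Ωs λ {K} _ → trans (∑-cong pts (λ {x} _ → ℕ.*-comm (deg x) _))
                                                             (∑-weighted-degree (λ x → [ incident x K ]))) ⟩
    ∑[ K ∈ Ωs ] ∑[ K′ ∈ Ωs ] ∑[ x ∈ pts ] ([ incident x K ] * [ incident x K′ ]) + ∑[ K ∈ Ωs ] A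
      ≡⟨ ∑-+ Ωs _ _ ⟨
    ∑[ K ∈ Ωs ] (∑[ K′ ∈ Ωs ] ∑[ x ∈ pts ] ([ incident x K ] * [ incident x K′ ]) + A)
      ≡⟨ ∑-cong Ωs (λ {K} K∈ → trans (cong (_+ A) (∑-cong Ωs (λ {K′} _ → ∑-incident² K K′))) (meets-Ω K∈)) ⟩
    ∑[ K ∈ Ωs ] (ω * A + A₁)
      ≡⟨ ∑-const Ωs _ ⟩
    ω * (ω * A + A₁) ∎

  line-sum : ∀ {h} → h ∈ pts → Ω h ≡ false → ∑[ x ∈ pts ] ([ incident x h ] * deg x) ≡ ω * A
  line-sum {h} h∈ h∉Ω = begin
    ∑[ x ∈ pts ] ([ incident x h ] * deg x)                          ≡⟨ ∑-weighted-degree (λ x → [ incident x h ]) ⟩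
    ∑[ K ∈ Ωs ] ∑[ x ∈ pts ] ([ incident x h ] * [ incident x K ])   ≡⟨ ∑-cong Ωs (λ {K} K∈ →
      trans (∑-incident² h K) (intersection-size h∈ (Ωs⊆pts K∈) (h≢ K∈))) ⟩
    ∑[ K ∈ Ωs ] A                                                    ≡⟨ ∑-const Ωs A ⟩
    ω * A                                                            ∎
    where
    h≢ : ∀ {K} → K ∈ Ωs → h ≢ K
    h≢ K∈ refl = contradiction (trans (sym h∉Ω) (Ω-member K∈)) λ ()

module TwoDegrees {Q : ℕ} (F : FiniteField Q) (t : ℕ) (Ω : Vec (FiniteField.Carrier F) (suc (suc t)) → Bool)
  (dB dO : ℤ)
  (two-valued : ∀ x → x ∈ PG.points F (suc t) → ℤ.+ PG.degree F (suc t) Ω x ≡ dB ⊎ ℤ.+ PG.degree F (suc t) Ω x ≡ dO)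
  where
  open import Data.Integer using (+_; -_; _+_; _-_; _*_; 0ℤ)
  open PG F using (incident)
  open PointCounts F using (hyperplane-size; length-points)
  open Incidence F t Ω

  black : Point → Bool
  black x = ⌊ + deg x ℤ.≟ dB ⌋

  |Ω|-quadratic : let A₂ = geometricSum Q (suc (suc t)) in
    + A * + ω * + ω + (+ A₁ - + A - (dB + dO) * + A₁) * + ω + dB * dO * + A₂ ≡ 0ℤ
  |Ω|-quadratic = quadratic-from-moments {+ A} {+ A₁} {+ geometricSum Q (suc (suc t))} {dB} {dO} {+ ω} second first squares
    where
    S₂ : ℕ
    S₂ = ∑[ x ∈ pts ] (deg x ℕ.* deg x)
    first : + ∑[ x ∈ pts ] deg x ≡ + ω * + A₁
    first = trans (cong +_ first-moment) (ℤ.pos-* ω A₁)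
    second : + S₂ + + ω * + A ≡ + ω * (+ ω * + A + + A₁)
    second = begin
      + S₂ + + ω * + A              ≡⟨ cong (λ n → + S₂ + n) (ℤ.pos-* ω A) ⟨
      + (S₂ ℕ.+ ω ℕ.* A)            ≡⟨ cong +_ second-moment ⟩
      + (ω ℕ.* (ω ℕ.* A ℕ.+ A₁))    ≡⟨ ℤ.pos-* ω _ ⟩
      + ω * + (ω ℕ.* A ℕ.+ A₁)      ≡⟨ cong (λ n → + ω * (n + + A₁)) (ℤ.pos-* ω A) ⟩
      + ω * (+ ω * + A + + A₁)      ∎
    squares : + S₂ ≡ (dB + dO) * + ∑[ x ∈ pts ] deg x + + geometricSum Q (suc (suc t)) * - (dB * dO)
    squares = begin
      + S₂
        ≡⟨ ∑-affine pts (λ x → deg x ℕ.* deg x) deg (dB + dO) (- (dB * dO)) (λ {x} x∈ →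
             trans (ℤ.pos-* (deg x) (deg x)) (two-valued-square (two-valued x x∈))) ⟩
      (dB + dO) * + ∑[ x ∈ pts ] deg x + + length pts * - (dB * dO)
        ≡⟨ cong (λ n → (dB + dO) * + ∑[ x ∈ pts ] deg x + + n * - (dB * dO)) (length-points (suc t)) ⟩
      (dB + dO) * + ∑[ x ∈ pts ] deg x + + geometricSum Q (suc (suc t)) * - (dB * dO) ∎

  black-on-hyperplane : ∀ {h} → h ∈ pts → Ω h ≡ false →
    (dB - dO) * + count (λ x → black x ∧ incident x h) pts ≡ + ω * + A - dO * + A₁
  black-on-hyperplane {h} h∈ h∉Ω = isolate (begin
    + (ω ℕ.* A)                                        ≡⟨ cong +_ (line-sum h∈ h∉Ω) ⟨
    + ∑[ x ∈ pts ] ([ incident x h ] ℕ.* deg x)       ≡⟨ cong +_ (∑-filterᵇ (λ x → incident x h) pts deg) ⟨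
    + ∑ on deg                                         ≡⟨ ∑-affine on deg (λ x → [ black x ]) (dB - dO) dO deg-black ⟩
    (dB - dO) * + count black on + + length on * dO    ≡⟨ cong₂ (λ b l → (dB - dO) * + b + + l * dO) black-on on-size ⟩
    (dB - dO) * + β + + A₁ * dO                        ∎)
    where
    on : List Point
    on = filterᵇ (λ x → incident x h) pts
    β : ℕ
    β = count (λ x → black x ∧ incident x h) pts
    black-on : count black on ≡ β
    black-on = trans (count-filterᵇ _ black pts) (∑-cong pts (λ {x} _ → cong [_] (∧-comm (incident x h) (black x))))
    on-size : length on ≡ A₁
    on-size = trans (length-filterᵇ _ pts) (hyperplane-size h∈)
    deg-black : ∀ {x} → x ∈ on → + deg x ≡ (dB - dO) * + [ black x ] + dO
    deg-black {x} x∈on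
      with + deg x ℤ.≟ dB | two-valued x (proj₁ (∈-filter⁻ (T? ∘ λ x → incident x h) {xs = pts} x∈on))
    ... | yes d≡dB | _         = trans d≡dB (at-black dB dO)
      where
      at-black : ∀ dB dO → dB ≡ (dB - dO) * + 1 + dO
      at-black = ℤ-Solver.solve-∀
    ... | no  d≢dB | inj₁ d≡dB = contradiction d≡dB d≢dB
    ... | no  _    | inj₂ d≡dO = trans d≡dO (at-other dB dO)
      where
      at-other : ∀ dB dO → dO ≡ (dB - dO) * + 0 + dO
      at-other = ℤ-Solver.solve-∀
    isolate : + (ω ℕ.* A) ≡ (dB - dO) * + β + + A₁ * dO → (dB - dO) * + β ≡ + ω * + A - dO * + A₁
    isolate eq = begin
      (dB - dO) * + β                            ≡⟨ rearrange (dB - dO) (+ β) (+ A₁) dO ⟩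
      (dB - dO) * + β + + A₁ * dO - dO * + A₁    ≡⟨ cong (_- dO * + A₁) (sym eq) ⟩
      + (ω ℕ.* A) - dO * + A₁                     ≡⟨ cong (_- dO * + A₁) (ℤ.pos-* ω A) ⟩
      + ω * + A - dO * + A₁                       ∎
      where
      rearrange : ∀ d b a o → d * b ≡ d * b + a * o - o * a
      rearrange = ℤ-Solver.solve-∀

-- The numbers of the theorem

module _ where
  open import Data.Integer using (+_; -_; _+_; _-_; _*_; _^_; 0ℤ; 1ℤ; -1ℤ; ∣_∣)
  open ℤ-Solver using (solve-∀; solve)

  record ForcedCount (A A₁ A₂ dB dO T : ℤ) : Set where
    field
      ω₀ : ℤ
      ω₀-root : A * ω₀ * ω₀ + (A₁ - A - (dB + dO) * A₁) * ω₀ + dB * dO * A₂ ≡ 0ℤ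
      A∤linear : ¬ (A ∣ A₁ - A - (dB + dO) * A₁)
      dB-dO≢0 : dB - dO ≢ 0ℤ
      target : (dB - dO) * T ≡ ω₀ * A - dO * A₁

    forced : ∀ {ω β} → A * ω * ω + (A₁ - A - (dB + dO) * A₁) * ω + dB * dO * A₂ ≡ 0ℤ →
      (dB - dO) * β ≡ ω * A - dO * A₁ → β ≡ T
    forced {ω} {β} ω-root line = ℤ.*-cancelˡ-≡ (dB - dO) β T {{ℤ.≢-nonZero dB-dO≢0}} (begin
      (dB - dO) * β     ≡⟨ line ⟩
      ω * A - dO * A₁   ≡⟨ cong (λ w → w * A - dO * A₁) (quadratic-root-unique ω-root ω₀-root A∤linear) ⟩
      ω₀ * A - dO * A₁  ≡⟨ target ⟨
      (dB - dO) * T     ∎)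

  ForcedCount-subst : ∀ {A A₁ A₂ dB dO T A′ A₁′ A₂′ dB′ dO′ T′} →
    A ≡ A′ → A₁ ≡ A₁′ → A₂ ≡ A₂′ → dB ≡ dB′ → dO ≡ dO′ → T ≡ T′ →
    ForcedCount A A₁ A₂ dB dO T → ForcedCount A′ A₁′ A₂′ dB′ dO′ T′
  ForcedCount-subst refl refl refl refl refl refl fc = fc

  HermitianForcedCount : ℕ → ℕ → Set
  HermitianForcedCount q t =
    ForcedCount (+ geometricSum (q ℕ.* q) t) (+ geometricSum (q ℕ.* q) (suc t)) (+ geometricSum (q ℕ.* q) (suc (suc t)))
                (blackDeg q t) (otherDeg q t) (1ℤ + + (q ℕ.* q) * N q (t ∸ 1))

  geometricSum-suc-ℤ : ∀ q n → + geometricSum (q ℕ.* q) (suc n) ≡ 1ℤ + + q * + q * + geometricSum (q ℕ.* q) n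
  geometricSum-suc-ℤ q n = begin
    + (1 ℕ.+ q ℕ.* q ℕ.* geometricSum (q ℕ.* q) n)      ≡⟨ ℤ.pos-+ 1 _ ⟩
    1ℤ + + (q ℕ.* q ℕ.* geometricSum (q ℕ.* q) n)       ≡⟨ cong (λ n → 1ℤ + n) (ℤ.pos-* (q ℕ.* q) _) ⟩
    1ℤ + + (q ℕ.* q) * + geometricSum (q ℕ.* q) n       ≡⟨ cong (λ Q → 1ℤ + Q * + geometricSum (q ℕ.* q) n) (ℤ.pos-* q q) ⟩
    1ℤ + + q * + q * + geometricSum (q ℕ.* q) n         ∎

  power-double : ∀ q m → (+ q) ^ (m ℕ.+ m) ≡ 1ℤ + (+ q * + q - 1ℤ) * + geometricSum (q ℕ.* q) m
  power-double q zero    = base (+ q)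
    where
    base : ∀ q → 1ℤ ≡ 1ℤ + (q * q - 1ℤ) * 0ℤ
    base = solve-∀
  power-double q (suc m) = begin
    + q * (+ q) ^ (m ℕ.+ suc m)                    ≡⟨ cong (λ n → + q * (+ q) ^ n) (ℕ.+-suc m m) ⟩
    + q * (+ q * (+ q) ^ (m ℕ.+ m))                ≡⟨ cong (λ E → + q * (+ q * E)) (power-double q m) ⟩
    + q * (+ q * (1ℤ + (+ q * + q - 1ℤ) * H))      ≡⟨ step (+ q) H ⟩
    1ℤ + (+ q * + q - 1ℤ) * (1ℤ + + q * + q * H)   ≡⟨ cong (λ H′ → 1ℤ + (+ q * + q - 1ℤ) * H′) (geometricSum-suc-ℤ q m) ⟨
    1ℤ + (+ q * + q - 1ℤ) * + geometricSum (q ℕ.* q) (suc m) ∎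
    where
    H : ℤ
    H = + geometricSum (q ℕ.* q) m
    step : ∀ q H → q * (q * (1ℤ + (q * q - 1ℤ) * H)) ≡ 1ℤ + (q * q - 1ℤ) * (1ℤ + q * q * H)
    step = solve-∀

  geometricSum-double : ∀ q m → let H = + geometricSum (q ℕ.* q) m in
    + geometricSum (q ℕ.* q) (m ℕ.+ m) ≡ H * (1ℤ + (1ℤ + (+ q * + q - 1ℤ) * H))
  geometricSum-double q zero    = base (+ q)
    where
    base : ∀ q → 0ℤ ≡ 0ℤ * (1ℤ + (1ℤ + (q * q - 1ℤ) * 0ℤ))
    base = solve-∀
  geometricSum-double q (suc m) = begin
    + geometricSum (q ℕ.* q) (suc m ℕ.+ suc m)
      ≡⟨ cong (λ n → + geometricSum (q ℕ.* q) (suc n)) (ℕ.+-suc m m) ⟩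
    + geometricSum (q ℕ.* q) (suc (suc (m ℕ.+ m)))
      ≡⟨ geometricSum-suc-ℤ q (suc (m ℕ.+ m)) ⟩
    1ℤ + + q * + q * + geometricSum (q ℕ.* q) (suc (m ℕ.+ m))
      ≡⟨ cong (λ n → 1ℤ + + q * + q * n) (geometricSum-suc-ℤ q (m ℕ.+ m)) ⟩
    1ℤ + + q * + q * (1ℤ + + q * + q * + geometricSum (q ℕ.* q) (m ℕ.+ m))
      ≡⟨ cong (λ n → 1ℤ + + q * + q * (1ℤ + + q * + q * n)) (geometricSum-double q m) ⟩
    1ℤ + + q * + q * (1ℤ + + q * + q * (H * (1ℤ + (1ℤ + (+ q * + q - 1ℤ) * H))))
      ≡⟨ step (+ q) H ⟩
    (1ℤ + + q * + q * H) * (1ℤ + (1ℤ + (+ q * + q - 1ℤ) * (1ℤ + + q * + q * H)))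
      ≡⟨ cong (λ H′ → H′ * (1ℤ + (1ℤ + (+ q * + q - 1ℤ) * H′))) (geometricSum-suc-ℤ q m) ⟨
    + geometricSum (q ℕ.* q) (suc m) * (1ℤ + (1ℤ + (+ q * + q - 1ℤ) * + geometricSum (q ℕ.* q) (suc m))) ∎
    where
    H : ℤ
    H = + geometricSum (q ℕ.* q) m
    step : ∀ q H → 1ℤ + q * q * (1ℤ + q * q * (H * (1ℤ + (1ℤ + (q * q - 1ℤ) * H)))) ≡
                   (1ℤ + q * q * H) * (1ℤ + (1ℤ + (q * q - 1ℤ) * (1ℤ + q * q * H)))
    step = solve-∀

  geometricSum-suc-double : ∀ q m → let H = + geometricSum (q ℕ.* q) m in
    + geometricSum (q ℕ.* q) (suc (m ℕ.+ m)) ≡ 1ℤ + + q * + q * (H * (1ℤ + (1ℤ + (+ q * + q - 1ℤ) * H)))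
  geometricSum-suc-double q m =
    trans (geometricSum-suc-ℤ q (m ℕ.+ m)) (cong (λ n → 1ℤ + + q * + q * n) (geometricSum-double q m))

  sgn-double : ∀ m → sgn (m ℕ.+ m) ≡ 1ℤ
  sgn-double zero    = refl
  sgn-double (suc m) = begin
    sgn (suc m ℕ.+ suc m)        ≡⟨ cong (λ n → sgn (suc n)) (ℕ.+-suc m m) ⟩
    -1ℤ * (-1ℤ * sgn (m ℕ.+ m))  ≡⟨ cong (λ s → -1ℤ * (-1ℤ * s)) (sgn-double m) ⟩
    1ℤ                           ∎

  -- Closed forms dB, dO, Nₛ₋₂ of blackDeg, otherDeg and N, in terms of x = q^t, y = q^(t-1), σ = (-1)^t,
  -- τ = (-1)^(t-1) and A = [t]; ω₀ = q² dO - σ q x is the number of hyperplanes of Ω, and k, r give the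
  -- linear coefficient of its quadratic modulo A.
  record ClosedForms (q x y σ τ A : ℤ) : Set where
    field
      dB dO Nₛ₋₂ k r : ℤ
      blackDeg-numerator : q * x * (x - σ) ≡ dB * (1ℤ + q)
      otherDeg-numerator : x * (q * x - -1ℤ * σ) ≡ dO * (1ℤ + q)
      N-numerator : (q * y + τ) * (y - τ) ≡ Nₛ₋₂ * (q * q - 1ℤ)
      ω₀-root : let ω₀ = q * q * dO - σ * q * x ; A₁ = 1ℤ + q * q * A in
        A * ω₀ * ω₀ + (A₁ - A - (dB + dO) * A₁) * ω₀ + dB * dO * (1ℤ + q * q * A₁) ≡ 0ℤ
      degree-sum : dB + dO ≡ 1ℤ + A * k - r
      black-count : σ * x * (1ℤ + q * q * Nₛ₋₂ - q * A) ≡ dO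
      dB-dO : dB - dO ≡ - (σ * x)

  target-from-black-count : ∀ {Q q σ x A T dO : ℤ} → σ * x * (T - q * A) ≡ dO →
    - (σ * x) * T ≡ (Q * dO - σ * q * x) * A - dO * (1ℤ + Q * A)
  target-from-black-count {Q} {q} {σ} {x} {A} {T} refl = identity Q q σ x A T
    where
    identity : ∀ Q q σ x A T →
      - (σ * x) * T ≡ (Q * (σ * x * (T - q * A)) - σ * q * x) * A - σ * x * (T - q * A) * (1ℤ + Q * A)
    identity = solve-∀

  linear-coefficient-mod : ∀ {Q A s k r : ℤ} → s ≡ 1ℤ + A * k - r →
    1ℤ + Q * A - A - s * (1ℤ + Q * A) ≡ A * (Q - 1ℤ - Q * s - k) + r
  linear-coefficient-mod {Q} {A} {k = k} {r} refl = identity Q A k r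
    where
    identity : ∀ Q A k r →
      1ℤ + Q * A - A - (1ℤ + A * k - r) * (1ℤ + Q * A) ≡ A * (Q - 1ℤ - Q * (1ℤ + A * k - r) - k) + r
    identity = solve-∀

  -- q = p + 2 makes the divisor q² - 1 in the definition of N visibly a successor
  closedForms⇒forcedCount : ∀ p t {x y σ τ A} → let q = suc (suc p) in
    (+ q) ^ t ≡ x → (+ q) ^ (t ∸ 1) ≡ y → sgn t ≡ σ → sgn (t ∸ 1) ≡ τ → + geometricSum (q ℕ.* q) t ≡ A →
    (cf : ClosedForms (+ q) x y σ τ A) → ClosedForms.r cf ≢ 0ℤ → ∣ ClosedForms.r cf ∣ ℕ.< geometricSum (q ℕ.* q) t →
    HermitianForcedCount q t
  closedForms⇒forcedCount p t refl refl refl refl refl cf r≢0 ∣r∣<A =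
    ForcedCount-subst refl (sym A₁≡) (sym A₂≡) (sym dB≡) (sym dO≡) (sym T≡) record
      { ω₀ = + q * + q * dO - sgn t * + q * (+ q) ^ t
      ; ω₀-root = ω₀-root
      ; A∤linear = a∤a*k+r _ r≢0 ∣r∣<A ∘ subst (A ∣_) (linear-coefficient-mod {Q = + q * + q} {A = A} degree-sum)
      ; dB-dO≢0 = σx≢0 ∘ trans (sym (ℤ.neg-involutive _)) ∘ cong -_ ∘ trans (sym dB-dO)
      ; target = trans (cong (λ d → d * (1ℤ + + q * + q * Nₛ₋₂)) dB-dO)
                       (target-from-black-count {+ q * + q} {+ q} {sgn t} {(+ q) ^ t} {A} black-count)
      }
    where
    open ClosedForms cf
    q : ℕ
    q = suc (suc p)
    A : ℤ
    A = + geometricSum (q ℕ.* q) t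
    σx≢0 : sgn t * (+ q) ^ t ≢ 0ℤ
    σx≢0 eq with ℤ.i*j≡0⇒i≡0∨j≡0 (sgn t) eq
    ... | inj₁ sgn≡0   = case ℤ.i^n≡0⇒i≡0 -1ℤ t sgn≡0 of λ ()
    ... | inj₂ power≡0 = case ℤ.i^n≡0⇒i≡0 (+ q) t power≡0 of λ ()
    A₁≡ : + geometricSum (q ℕ.* q) (suc t) ≡ 1ℤ + + q * + q * A
    A₁≡ = geometricSum-suc-ℤ q t
    A₂≡ : + geometricSum (q ℕ.* q) (suc (suc t)) ≡ 1ℤ + + q * + q * (1ℤ + + q * + q * A)
    A₂≡ = trans (geometricSum-suc-ℤ q (suc t)) (cong (λ A₁ → 1ℤ + + q * + q * A₁) A₁≡)
    dB≡ : blackDeg q t ≡ dB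
    dB≡ = divZ-exact {x = dB} q blackDeg-numerator
    dO≡ : otherDeg q t ≡ dO
    dO≡ = divZ-exact {x = dO} q otherDeg-numerator
    T≡ : 1ℤ + + (q ℕ.* q) * N q (t ∸ 1) ≡ 1ℤ + + q * + q * Nₛ₋₂
    T≡ = cong₂ (λ Q n → 1ℤ + Q * n) (ℤ.pos-* q q) (divZ-exact {x = Nₛ₋₂} (p ℕ.+ suc p ℕ.* suc (suc p)) N-numerator)

  -- t = 2m + 2, with H = [m], so that q^t = Q E where E = Q^m = 1 + (Q - 1) H
  even-closedForms : ∀ q H → let Q = q * q ; E = 1ℤ + (Q - 1ℤ) * H in
    ClosedForms q (q * (q * E)) (q * E) 1ℤ -1ℤ (1ℤ + Q * (1ℤ + Q * (H * (1ℤ + E))))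
  even-closedForms q H =
    let p = q - 1ℤ ; Q = q * q ; E = 1ℤ + (Q - 1ℤ) * H
    in record
    { dB = q * Q * p * E * (1ℤ + Q * H)
    ; dO = Q * E * (Q - q + 1ℤ + q * Q * p * H)
    ; Nₛ₋₂ = (1ℤ + Q * H) * (q * E + 1ℤ)
    ; k = q * p + q * p
    ; r = p * p * (1ℤ + Q * H)
    ; blackDeg-numerator = solve (q ∷ H ∷ [])
    ; otherDeg-numerator = solve (q ∷ H ∷ [])
    ; N-numerator = solve (q ∷ H ∷ [])
    ; ω₀-root = solve (q ∷ H ∷ [])
    ; degree-sum = solve (q ∷ H ∷ [])
    ; black-count = solve (q ∷ H ∷ [])
    ; dB-dO = solve (q ∷ H ∷ [])
    }

  -- t = 2m + 3, with the same H and E, so that q^t = q Q E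
  odd-closedForms : ∀ q H → let Q = q * q ; E = 1ℤ + (Q - 1ℤ) * H in
    ClosedForms q (q * (q * (q * E))) (q * (q * E)) -1ℤ 1ℤ (1ℤ + Q * (1ℤ + Q * (1ℤ + Q * (H * (1ℤ + E)))))
  odd-closedForms q H =
    let p = q - 1ℤ ; Q = q * q ; E = 1ℤ + (Q - 1ℤ) * H
    in record
    { dB = Q * Q * E * (Q - q + 1ℤ + q * Q * p * H)
    ; dO = q * Q * E * p * (Q + 1ℤ + Q * Q * H)
    ; Nₛ₋₂ = (q * Q * E + 1ℤ) * (1ℤ + Q * H)
    ; k = q * p + q * p
    ; r = - (p * (1ℤ + q * p * (1ℤ + Q * H)))
    ; blackDeg-numerator = solve (q ∷ H ∷ [])
    ; otherDeg-numerator = solve (q ∷ H ∷ [])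
    ; N-numerator = solve (q ∷ H ∷ [])
    ; ω₀-root = solve (q ∷ H ∷ [])
    ; degree-sum = solve (q ∷ H ∷ [])
    ; black-count = solve (q ∷ H ∷ [])
    ; dB-dO = solve (q ∷ H ∷ [])
    }


module _ where
  open import Data.Nat using (_+_; _*_; _^_; _<_)

  even-remainder< : ∀ p m → let q = suc (suc p) ; Q = q * q in
    suc p * suc p * (1 + Q * geometricSum Q m) < geometricSum Q (2 + (m + m))
  even-remainder< p m = subst (ρ <_) (sym (trans (cong (λ g → 1 + Q * (1 + Q * g)) (geometricSum-+ Q m m))
                                                 (slack (suc p) (geometricSum Q m) (Q ^ m))))
                              (ℕ.m<m+n ρ ℕ.z<s)
    where
    Q ρ : ℕ
    Q = suc (suc p) * suc (suc p)
    ρ = suc p * suc p * (1 + Q * geometricSum Q m)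
    slack : ∀ a h e → let Q = suc a * suc a in
      1 + Q * (1 + Q * (h + e * h)) ≡ a * a * (1 + Q * h) + suc ((2 * a + 1) * (1 + Q * h) + Q * Q * e * h)
    slack = ℕ-Solver.solve-∀

  odd-remainder< : ∀ p m → let q = suc (suc p) ; Q = q * q in
    suc p * (1 + q * suc p * (1 + Q * geometricSum Q m)) < geometricSum Q (3 + (m + m))
  odd-remainder< p m = subst (ρ <_) (sym (trans (cong (λ g → 1 + Q * (1 + Q * (1 + Q * g))) (geometricSum-+ Q m m))
                                                (slack (suc p) (geometricSum Q m) (Q ^ m))))
                             (ℕ.m<m+n ρ ℕ.z<s)
    where
    Q ρ : ℕ
    Q = suc (suc p) * suc (suc p)
    ρ = suc p * (1 + suc (suc p) * suc p * (1 + Q * geometricSum Q m))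
    slack : ∀ a h e → let q = suc a ; Q = q * q in
      1 + Q * (1 + Q * (1 + Q * (h + e * h))) ≡
      a * (1 + q * a * (1 + Q * h)) +
      suc (a * a + a + 1 + q * (a * a * a + 2 * a * a + 3 * a + 1) * (1 + Q * h) + Q * Q * Q * e * h)
    slack = ℕ-Solver.solve-∀

module _ where
  open import Data.Integer using (+_; -_; _+_; _-_; _*_; _^_; 0ℤ; 1ℤ; -1ℤ; ∣_∣)

  forcedCount-even : ∀ p m → HermitianForcedCount (suc (suc p)) (2 ℕ.+ (m ℕ.+ m))
  forcedCount-even p m = closedForms⇒forcedCount p t
    (cong (λ E → + q * (+ q * E)) E≡) (cong (λ E → + q * E) E≡)
    (cong (λ s → -1ℤ * (-1ℤ * s)) (sgn-double m)) (cong (λ s → -1ℤ * s) (sgn-double m))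
    (trans (geometricSum-suc-ℤ q (suc (m ℕ.+ m))) (cong (λ n → 1ℤ + + q * + q * n) (geometricSum-suc-double q m)))
    (even-closedForms (+ q) (+ h))
    (λ r≡0 → case trans ρ≡r r≡0 of λ ())
    (subst (ℕ._< geometricSum (q ℕ.* q) t) (cong ∣_∣ ρ≡r) (even-remainder< p m))
    where
    q h t : ℕ
    q = suc (suc p)
    h = geometricSum (q ℕ.* q) m
    t = 2 ℕ.+ (m ℕ.+ m)
    E≡ : (+ q) ^ (m ℕ.+ m) ≡ 1ℤ + (+ q * + q - 1ℤ) * + h
    E≡ = power-double q m
    ρ≡r : + (suc p ℕ.* suc p ℕ.* (1 ℕ.+ q ℕ.* q ℕ.* h)) ≡ + suc p * + suc p * (1ℤ + + q * + q * + h)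
    ρ≡r = trans (ℤ.pos-* (suc p ℕ.* suc p) _) (cong₂ _*_ (ℤ.pos-* (suc p) (suc p))
            (cong (λ n → 1ℤ + n) (trans (ℤ.pos-* (q ℕ.* q) h) (cong (_* + h) (ℤ.pos-* q q)))))

  forcedCount-odd : ∀ p m → HermitianForcedCount (suc (suc p)) (3 ℕ.+ (m ℕ.+ m))
  forcedCount-odd p m = closedForms⇒forcedCount p t
    (cong (λ E → + q * (+ q * (+ q * E))) E≡) (cong (λ E → + q * (+ q * E)) E≡)
    (cong (λ s → -1ℤ * (-1ℤ * (-1ℤ * s))) (sgn-double m)) (cong (λ s → -1ℤ * (-1ℤ * s)) (sgn-double m))
    (trans (geometricSum-suc-ℤ q (2 ℕ.+ (m ℕ.+ m))) (cong (λ n → 1ℤ + + q * + q * n) A″≡))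
    (odd-closedForms (+ q) (+ h))
    (λ r≡0 → case trans (cong -_ ρ≡r) r≡0 of λ ())
    (subst (ℕ._< geometricSum (q ℕ.* q) t) (trans (sym (ℤ.∣-i∣≡∣i∣ (+ ρ))) (cong (∣_∣ ∘ -_) ρ≡r)) (odd-remainder< p m))
    where
    q h t ρ : ℕ
    q = suc (suc p)
    h = geometricSum (q ℕ.* q) m
    t = 3 ℕ.+ (m ℕ.+ m)
    ρ = suc p ℕ.* (1 ℕ.+ q ℕ.* suc p ℕ.* (1 ℕ.+ q ℕ.* q ℕ.* h))
    E≡ : (+ q) ^ (m ℕ.+ m) ≡ 1ℤ + (+ q * + q - 1ℤ) * + h
    E≡ = power-double q m
    A″≡ : + geometricSum (q ℕ.* q) (2 ℕ.+ (m ℕ.+ m)) ≡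
          1ℤ + + q * + q * (1ℤ + + q * + q * (+ h * (1ℤ + (1ℤ + (+ q * + q - 1ℤ) * + h))))
    A″≡ = trans (geometricSum-suc-ℤ q (suc (m ℕ.+ m))) (cong (λ n → 1ℤ + + q * + q * n) (geometricSum-suc-double q m))
    ρ≡r : + ρ ≡ + suc p * (1ℤ + + q * + suc p * (1ℤ + + q * + q * + h))
    ρ≡r = trans (ℤ.pos-* (suc p) _) (cong (λ n → + suc p * (1ℤ + n)) (trans (ℤ.pos-* (q ℕ.* suc p) _)
            (cong₂ _*_ (ℤ.pos-* q (suc p)) (cong (λ n → 1ℤ + n) (trans (ℤ.pos-* (q ℕ.* q) h) (cong (_* + h) (ℤ.pos-* q q)))))))

  parity : ∀ n → ∃[ m ] (n ≡ m ℕ.+ m ⊎ n ≡ suc (m ℕ.+ m))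
  parity zero    = 0 , inj₁ refl
  parity (suc n) with parity n
  ... | m , inj₁ refl = m , inj₂ refl
  ... | m , inj₂ refl = suc m , inj₁ (cong suc (sym (ℕ.+-suc m m)))

  hermitian-forcedCount : ∀ p n → HermitianForcedCount (suc (suc p)) (2 ℕ.+ n)
  hermitian-forcedCount p n with parity n
  ... | m , inj₁ refl = forcedCount-even p m
  ... | m , inj₂ refl = forcedCount-odd p m

open import Data.Nat using (_<_; _≤_; _*_)
open import Data.Integer using (+_) renaming (_+_ to _+ℤ_; _*_ to _*ℤ_)
open import Data.Integer.Properties using () renaming (_≟_ to _≟ℤ_)

mainTheorem9 : (q : ℕ) → IsPrimePower q → 2 < q →
    (t : ℕ) → 2 ≤ t →
    (F : FiniteField (q * q)) →
    let open FiniteField F using (Carrier) in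
    let open PG F in
    (Ω : Vec Carrier (suc (suc t)) → Bool) →
    (∃[ h ] (h ∈ hyperplanes (suc t) × Ω h ≡ true)) →
    (∀ x → x ∈ points (suc t) →
       (+ degree (suc t) Ω x ≡ blackDeg q t) ⊎ (+ degree (suc t) Ω x ≡ otherDeg q t)) →
    ∀ h → h ∈ hyperplanes (suc t) → Ω h ≡ false →
      + length (filterᵇ (λ x → ⌊ + degree (suc t) Ω x ≟ℤ blackDeg q t ⌋ ∧ incident x h)
                        (points (suc t)))
        ≡ (+ 1) +ℤ (+ (q * q)) *ℤ N q (t ∸ 1)
mainTheorem9 q@(suc (suc p)) _ (s≤s (s≤s _)) t@(suc (suc n)) (s≤s (s≤s _)) F Ω _ two-valued h h∈ h∉Ω =
  trans (cong +_ (length-filterᵇ _ pts))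
        (ForcedCount.forced (hermitian-forcedCount p n) {+ ω} |Ω|-quadratic (black-on-hyperplane h∈ h∉Ω))
  where
  open Incidence F t Ω
  open TwoDegrees F t Ω (blackDeg q t) (otherDeg q t) two-valued
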